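{- For every integer $n\ge1$, $\operatorname{num}_{\mathcal T}(n,-1)=3^{v_3(n!)}$. In particular, for every $n\ge1$, $\operatorname{num}_{\mathcal T}(3n,-1)=\operatorname{num}_{\mathcal T}(3n+1,-1)=\operatorname{num}_{\mathcal T}(3n+2,-1)=3^{v_3((3n)!)}$.
   Context: A ternary partition of $n$ is a partition of $n$ (a finite nonincreasing sequence of positive integers summing to $n$) all of whose parts are powers of $3$ (including $1$); let $\mathcal T(n)$ be the set of ternary partitions of $n$, and let $m_\lambda(i)$ be the number of parts of $\lambda$ equal to $i$. For $\lambda\in\mathcal T(n)$ set $h_{\mathcal T,\lambda}(x)=\prod_{k\ge0}(1+x^{3^k})^{\lfloor n/3^k\rfloor-m_\lambda(3^k)}$, let $G_{\mathcal T}(n,x)$ be the greatest common divisor in $\mathbb{Z}[x]$ (positive leading coefficient) of the $h_{\mathcal T,\lambda}(x)$ over $\lambda\in\mathcal T(n)$, and define the polynomial $\operatorname{num}_{\mathcal T}(n,x)=\frac{1}{G_{\mathcal T}(n,x)}\sum_{\lambda\in\mathcal T(n)}h_{\mathcal T,\lambda}(x)$. $v_3(M)$ is the exponent of $3$ in the positive integer $M$. -}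

module Defs where

open import Data.Nat as ℕ using (ℕ; zero; suc; _≥_; _^_; _∸_)
open import Data.Nat.Properties using (m^n≢0)
open import Data.Nat.DivMod using (_/_)
open import Data.Nat.Divisibility using (_∣_)
open import Data.Integer as ℤ using (ℤ; +_)
open import Data.List using (List; []; _∷_; map; foldr; replicate; _++_; upTo; filter; length)
open import Data.Nat.ListAction using (sum)
open import Data.List.Relation.Unary.All using (All)
open import Data.List.Relation.Unary.Linked using (Linked)
open import Data.List.Relation.Unary.Unique.Propositional using (Unique)
open import Data.List.Membership.Propositional using (_∈_)
open import Data.Product using (Σ; ∃; _×_; _,_)
open import Relation.Binary.PropositionalEquality using (_≡_)
open import Relation.Nullary using (¬_)
open import Function.Bundles using (_⇔_)

-- Polynomials in ℤ[x]: coefficient lists, constant term first.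
Poly : Set
Poly = List ℤ

coeff : Poly → ℕ → ℤ
coeff []       _       = + 0
coeff (a ∷ p)  zero    = a
coeff (a ∷ p)  (suc i) = coeff p i

-- equality of polynomials (coefficientwise; trailing zeros irrelevant)
_≈ₚ_ : Poly → Poly → Set
p ≈ₚ q = ∀ i → coeff p i ≡ coeff q i

_+ₚ_ : Poly → Poly → Poly
[]      +ₚ q       = q
(a ∷ p) +ₚ []      = a ∷ p
(a ∷ p) +ₚ (b ∷ q) = (a ℤ.+ b) ∷ (p +ₚ q)

_*ₚ_ : Poly → Poly → Poly
[]      *ₚ q = []
(a ∷ p) *ₚ q = map (a ℤ.*_) q +ₚ (+ 0 ∷ (p *ₚ q))

oneₚ : Poly
oneₚ = + 1 ∷ []

_^ₚ_ : Poly → ℕ → Poly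
p ^ₚ zero    = oneₚ
p ^ₚ suc k   = p *ₚ (p ^ₚ k)

sumₚ : List Poly → Poly
sumₚ = foldr _+ₚ_ []

prodₚ : List Poly → Poly
prodₚ = foldr _*ₚ_ oneₚ

monomial : ℕ → Poly
monomial m = replicate m (+ 0) ++ (+ 1 ∷ [])

eval : Poly → ℤ → ℤ
eval p x = foldr (λ a acc → a ℤ.+ x ℤ.* acc) (+ 0) p

_∣ₚ_ : Poly → Poly → Set
d ∣ₚ p = Σ Poly λ q → (q *ₚ d) ≈ₚ p

PosLeading : Poly → Set
PosLeading p = Σ ℕ λ d → (+ 0 ℤ.< coeff p d) × (∀ i → d ℕ.< i → coeff p i ≡ + 0)

IsGcdₚ : List Poly → Poly → Set
IsGcdₚ hs G =
  (∀ {h} → h ∈ hs → G ∣ₚ h) ×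
  (∀ D → (∀ {h} → h ∈ hs → D ∣ₚ h) → D ∣ₚ G) ×
  PosLeading G

IsPowerOf3 : ℕ → Set
IsPowerOf3 p = ∃ λ k → p ≡ 3 ^ k

IsTernaryPartition : ℕ → List ℕ → Set
IsTernaryPartition n λs = Linked _≥_ λs × All IsPowerOf3 λs × sum λs ≡ n

mult : List ℕ → ℕ → ℕ
mult λs i = length (filter (ℕ._≟ i) λs)

div3^ : ℕ → ℕ → ℕ
div3^ n k = _/_ n (3 ^ k) {{m^n≢0 3 k}}

-- h_{T,λ}(x) = ∏_{k ≥ 0} (1 + x^{3^k})^{⌊n/3^k⌋ - m_λ(3^k)}.
-- Factors with k > n have exponent 0 (3^k > n), so the product over
-- k ∈ {0,…,n} is the full product.
hT : ℕ → List ℕ → Poly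
hT n λs = prodₚ (map (λ k → (oneₚ +ₚ monomial (3 ^ k)) ^ₚ (div3^ n k ∸ mult λs (3 ^ k))) (upTo (suc n)))

-- The value num_T(n, -1) equals v: for any duplicate-free enumeration L
-- of T(n), the gcd G of the h_{T,λ}, and the quotient polynomial N with
-- N · G = Σ_λ h_{T,λ}, we have N(-1) = v.
NumTAtMinusOne : ℕ → ℤ → Set
NumTAtMinusOne n v =
  (L : List (List ℕ)) → Unique L → (∀ λs → (λs ∈ L) ⇔ IsTernaryPartition n λs) →
  (G : Poly) → IsGcdₚ (map (hT n) L) G →
  (N : Poly) → (N *ₚ G) ≈ₚ sumₚ (map (hT n) L) →
  eval N (ℤ.- (+ 1)) ≡ v

IsV3 : ℕ → ℕ → Set
IsV3 M e = (3 ^ e ∣ M) × ¬ (3 ^ suc e ∣ M)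

-- Write P k = 1 + x^(3^k) and Q k for the cyclotomic polynomial Φ_(2·3^k), so that
-- P k = Q 0 ⋯ Q k. With ν_j(λ) the number of parts of λ that are ≥ 3^j (at most ⌊n/3^j⌋,
-- since these parts sum to at most n), the exponent of Q j in h_{T,λ} is
--   Σ_(k≥j) (⌊n/3^k⌋ - m_λ(3^k)) = (⌊n/3^j⌋ - ν_j(λ)) + Σ_(k≥j) ⌊n/3^(k+1)⌋,
-- so h_{T,λ} = q_λ · G₀ with G₀ = ∏_k P_k^⌊n/3^(k+1)⌋ independent of λ and
-- q_λ = ∏_j Q_j^(⌊n/3^j⌋ - ν_j(λ)). The q_λ have no common factor: distinct Q's generate
-- an ideal containing a power of 3, q_(1ⁿ) has no factor Q 0, the partition of n into as
-- many parts 3^j as possible plus ones has no factor Q j, and q_(1ⁿ)(0) = 1. Hence the gcd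
-- is G₀ and num_T(n, x) = Σ_λ q_λ. Finally Q 0 (-1) = 0, Q (j+1) (-1) = 3, and 1ⁿ is the
-- only partition without a factor Q 0, so num_T(n, -1) = 3^(Σ_(j≥1) ⌊n/3^j⌋), which is
-- 3^(v₃(n!)) by Legendre's formula.

{-# OPTIONS --safe #-}
module Submission where

open import Defs
open import Data.Nat as ℕ using (ℕ; zero; suc; z≤n; s≤s; _+_; _*_; _^_; _∸_; _≤_; _<_; _≥_; _!; NonZero)
import Data.Nat.Properties as ℕₚ
open import Data.Integer as ℤ using (ℤ; +_; -1ℤ)
import Data.Integer.Properties as ℤₚ
open import Data.Nat.DivMod using (_/_; _%_; m*n/n≡m; /-monoˡ-≤; n/1≡n; m<n⇒m/n≡0; m≡m%n+[m/n]*n)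
open import Data.List using (List; []; _∷_; _++_; map; applyUpTo; filter; length; replicate)
open import Data.List.Properties using (filter-++; filter-all; filter-none; length-++; length-replicate; ++-identityʳ)
open import Data.List.Relation.Unary.Linked using (Linked; []; [-]; _∷_)
import Data.List.Relation.Unary.All as All
import Data.List.Relation.Unary.All.Properties as Allₚ
open import Data.List.Relation.Unary.All using (All; []; _∷_)
open import Data.List.Relation.Unary.AllPairs using (_∷_)
open import Data.List.Relation.Unary.Any using (here; there)
open import Data.List.Relation.Unary.Unique.Propositional using (Unique)
open import Data.List.Membership.Propositional using (_∈_)
open import Data.List.Membership.Propositional.Properties using (∈-map⁻; ∈-map⁺)
open import Data.Nat.ListAction using (sum)
open import Data.Nat.ListAction.Properties using (sum-++)
open import Data.Maybe using (Maybe; just; nothing)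
open import Data.Product using (Σ; _×_; _,_; proj₁; proj₂)
open import Data.Sum using (_⊎_; inj₁; inj₂)
open import Data.Empty using (⊥-elim)
open import Relation.Nullary using (¬_; yes; no)
open import Function.Bundles using (Equivalence)
open import Relation.Binary.Definitions using (tri<; tri≈; tri>)
open import Algebra.Bundles using (CommutativeRing)
open import Algebra.Structures using (IsCommutativeRing)
open import Algebra.Properties.CommutativeSemigroup ℤₚ.+-commutativeSemigroup
  using () renaming (interchange to ℤ-+-interchange)
open import Algebra.Properties.CommutativeSemigroup ℕₚ.+-commutativeSemigroup
  using () renaming (interchange to ℕ-+-interchange)
open import Relation.Binary.PropositionalEquality
open import Relation.Binary.Structures using (IsEquivalence)
open import Relation.Binary.Bundles using (Setoid)
import Relation.Binary.Reasoning.Setoid as SetoidReasoning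
import Tactic.RingSolver.Core.AlmostCommutativeRing as ACR
open import Tactic.RingSolver using (solve-∀)
open import Data.Nat.Tactic.RingSolver using () renaming (solve-∀ to ℕ-solve-∀)
open import Data.Integer.Tactic.RingSolver using () renaming (solve-∀ to ℤ-solve-∀)

∑ : ℕ → (ℕ → ℕ) → ℕ
∑ zero    f = 0
∑ (suc M) f = f 0 + ∑ M (λ k → f (suc k))

syntax ∑ M (λ k → e) = ∑[ k < M ] e

∑-cong : ∀ {f g} M → (∀ k → k < M → f k ≡ g k) → ∑ M f ≡ ∑ M g
∑-cong zero    f≡g = refl
∑-cong (suc M) f≡g = cong₂ _+_ (f≡g 0 (s≤s z≤n)) (∑-cong M λ k k<M → f≡g (suc k) (s≤s k<M))

∑-zero : ∀ f M → (∀ k → f k ≡ 0) → ∑ M f ≡ 0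
∑-zero f zero    f≡0 = refl
∑-zero f (suc M) f≡0 = cong₂ _+_ (f≡0 0) (∑-zero (λ k → f (suc k)) M λ k → f≡0 (suc k))

∑-snoc : ∀ f M → ∑ (suc M) f ≡ ∑ M f + f M
∑-snoc f zero    = ℕₚ.+-comm (f 0) 0
∑-snoc f (suc M) = trans (cong (λ s → f 0 + s) (∑-snoc (λ k → f (suc k)) M)) (sym (ℕₚ.+-assoc (f 0) _ _))

∑-+ : ∀ f g M → ∑[ k < M ] (f k + g k) ≡ ∑ M f + ∑ M g
∑-+ f g zero    = refl
∑-+ f g (suc M) = trans (cong (λ s → f 0 + g 0 + s) (∑-+ (λ k → f (suc k)) (λ k → g (suc k)) M))
                        (ℕ-+-interchange (f 0) (g 0) _ _)

∑-∸ : ∀ f g M → (∀ k → k < M → g k ≤ f k) → ∑[ k < M ] (f k ∸ g k) ≡ ∑ M f ∸ ∑ M g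
∑-∸ f g M g≤f = begin
  ∑[ k < M ] (f k ∸ g k)                  ≡⟨ ℕₚ.m+n∸n≡m _ (∑ M g) ⟨
  ∑[ k < M ] (f k ∸ g k) + ∑ M g ∸ ∑ M g  ≡⟨ cong (_∸ ∑ M g) (∑-+ (λ k → f k ∸ g k) g M) ⟨
  ∑[ k < M ] (f k ∸ g k + g k) ∸ ∑ M g    ≡⟨ cong (_∸ ∑ M g) (∑-cong M λ k k<M → ℕₚ.m∸n+n≡m (g≤f k k<M)) ⟩
  ∑ M f ∸ ∑ M g                           ∎
  where open ≡-Reasoning

∑-∸-shift : ∀ f g M → (∀ k → k < M → g k ≤ f k) → f M ≡ 0 → ∑ M g ≤ f 0 →
  ∑[ k < M ] (f k ∸ g k) ≡ (f 0 ∸ ∑ M g) + ∑[ k < M ] f (suc k)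
∑-∸-shift f g M g≤f fM≡0 ∑g≤f0 = begin
  ∑[ k < M ] (f k ∸ g k)                ≡⟨ ∑-∸ f g M g≤f ⟩
  ∑ M f ∸ ∑ M g                         ≡⟨ cong (_∸ ∑ M g) ∑f≡ ⟩
  (f 0 + ∑[ k < M ] f (suc k)) ∸ ∑ M g  ≡⟨ ℕₚ.+-∸-comm _ ∑g≤f0 ⟩
  (f 0 ∸ ∑ M g) + ∑[ k < M ] f (suc k)  ∎
  where
  open ≡-Reasoning
  ∑f≡ : ∑ M f ≡ f 0 + ∑[ k < M ] f (suc k)
  ∑f≡ = trans (sym (ℕₚ.+-identityʳ _)) (trans (cong (λ s → ∑ M f + s) (sym fM≡0)) (sym (∑-snoc f M)))

∑-+-prefix : ∀ f g M t → t ≤ M → (∀ j → j < t → f j ≡ suc (g j)) → (∀ j → t ≤ j → f j ≡ g j) →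
  ∑ M f ≡ ∑ M g + t
∑-+-prefix f g M zero _ _ f≡g = trans (∑-cong M λ j _ → f≡g j z≤n) (sym (ℕₚ.+-identityʳ _))
∑-+-prefix f g (suc M) (suc t) (s≤s t≤M) f≡1+g f≡g = begin
  f 0 + ∑ M (λ j → f (suc j))              ≡⟨ cong₂ _+_ (f≡1+g 0 (s≤s z≤n)) tail ⟩
  suc (g 0) + (∑ M (λ j → g (suc j)) + t)  ≡⟨ regroup (g 0) _ t ⟩
  g 0 + ∑ M (λ j → g (suc j)) + suc t      ∎
  where
  open ≡-Reasoning
  tail : ∑ M (λ j → f (suc j)) ≡ ∑ M (λ j → g (suc j)) + t
  tail = ∑-+-prefix (λ j → f (suc j)) (λ j → g (suc j)) M t t≤M
           (λ j j<t → f≡1+g (suc j) (s≤s j<t)) (λ j t≤j → f≡g (suc j) (s≤s t≤j))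
  regroup : ∀ a b t → suc a + (b + t) ≡ a + b + suc t
  regroup = ℕ-solve-∀

∑-range : ℕ → ℕ → (ℕ → ℕ) → ℕ
∑-range i M f = ∑[ k < M ∸ i ] f (i + k)

syntax ∑-range i M (λ k → e) = ∑[ i ≤ k < M ] e

<∸⇒+< : ∀ {j k M} → k < M ∸ j → j + k < M
<∸⇒+< {j} {k} {M} k<M∸j = subst (j + k <_) (ℕₚ.m+[n∸m]≡n j≤M) (ℕₚ.+-monoʳ-< j k<M∸j)
  where
  j≤M : j ≤ M
  j≤M = ℕₚ.<⇒≤ (ℕₚ.m∸n≢0⇒n<m λ M∸j≡0 → ℕₚ.n≮0 (subst (k <_) M∸j≡0 k<M∸j))

head≤∑-range : ∀ μ {i M} → i < M → μ i ≤ ∑[ i ≤ k < M ] μ k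
head≤∑-range μ {i} {M} i<M with M ∸ i | ℕₚ.m<n⇒0<n∸m i<M
... | suc L | _ = subst (_≤ ∑ (suc L) (λ k → μ (i + k))) (cong μ (ℕₚ.+-identityʳ i)) (ℕₚ.m≤m+n _ _)

∑-range-∸-split : ∀ (a μ : ℕ → ℕ) M → (∀ i → i < M → ∑[ i ≤ k < M ] μ k ≤ a i) → a M ≡ 0 →
  ∀ j → j < M → ∑[ j ≤ k < M ] (a k ∸ μ k) ≡ (a j ∸ ∑[ j ≤ k < M ] μ k) + ∑[ j ≤ k < M ] a (suc k)
∑-range-∸-split a μ M ν≤a aM≡0 j j<M = begin
  ∑[ k < M ∸ j ] (a (j + k) ∸ μ (j + k))
    ≡⟨ ∑-∸-shift (λ k → a (j + k)) (λ k → μ (j + k)) (M ∸ j) μ≤a end≡0 ν≤a₀ ⟩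
  (a (j + 0) ∸ ∑[ j ≤ k < M ] μ k) + ∑[ k < M ∸ j ] a (j + suc k)
    ≡⟨ cong₂ (λ i s → (a i ∸ ∑[ j ≤ k < M ] μ k) + s) (ℕₚ.+-identityʳ j)
             (∑-cong (M ∸ j) λ k _ → cong a (ℕₚ.+-suc j k)) ⟩
  (a j ∸ ∑[ j ≤ k < M ] μ k) + ∑[ j ≤ k < M ] a (suc k)
    ∎
  where
  open ≡-Reasoning
  μ≤a : ∀ k → k < M ∸ j → μ (j + k) ≤ a (j + k)
  μ≤a k k<M∸j = ℕₚ.≤-trans (head≤∑-range μ (<∸⇒+< k<M∸j)) (ν≤a (j + k) (<∸⇒+< k<M∸j))
  end≡0 : a (j + (M ∸ j)) ≡ 0
  end≡0 = trans (cong a (ℕₚ.m+[n∸m]≡n (ℕₚ.<⇒≤ j<M))) aM≡0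
  ν≤a₀ : ∑[ j ≤ k < M ] μ k ≤ a (j + 0)
  ν≤a₀ = subst (λ i → ∑[ j ≤ k < M ] μ k ≤ a i) (sym (ℕₚ.+-identityʳ j)) (ν≤a j j<M)

mult-++ : ∀ xs ys v → mult (xs ++ ys) v ≡ mult xs v + mult ys v
mult-++ xs ys v = trans (cong length (filter-++ (ℕ._≟ v) xs ys)) (length-++ (filter (ℕ._≟ v) xs))

mult-replicate : ∀ m x → mult (replicate m x) x ≡ m
mult-replicate m x = trans (cong length (filter-all (ℕ._≟ x) (Allₚ.replicate⁺ m refl))) (length-replicate m)

mult-replicate-≢ : ∀ m {x v} → x ≢ v → mult (replicate m x) v ≡ 0
mult-replicate-≢ m {v = v} x≢v = cong length (filter-none (ℕ._≟ v) (Allₚ.replicate⁺ m x≢v))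

StrictlyIncreasing : (ℕ → ℕ) → Set
StrictlyIncreasing s = ∀ k l → k < l → s k < s l

∑-mult-singleton : ∀ x (s : ℕ → ℕ) L → StrictlyIncreasing s →
  (∑[ k < L ] mult (x ∷ []) (s k) ≤ 1) × ((∑[ k < L ] mult (x ∷ []) (s k)) * s 0 ≤ x)
∑-mult-singleton x s zero    _  = z≤n , z≤n
∑-mult-singleton x s (suc L) s↑ with x ℕ.≟ s 0
... | yes x≡s₀ = subst (λ c → c ≤ 1 × c * s 0 ≤ x) (sym count≡1)
                   (ℕₚ.≤-refl , ℕₚ.≤-reflexive (trans (ℕₚ.+-identityʳ (s 0)) (sym x≡s₀)))
  where
  count≡1 : mult (x ∷ []) (s 0) + ∑[ k < L ] mult (x ∷ []) (s (suc k)) ≡ 1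
  count≡1 = cong₂ _+_ (subst (λ v → mult (x ∷ []) v ≡ 1) x≡s₀ (mult-replicate 1 x))
                        (∑-zero _ L λ k → mult-replicate-≢ 1 λ x≡sₖ₊₁ →
                           ℕₚ.<-irrefl (trans (sym x≡s₀) x≡sₖ₊₁) (s↑ 0 (suc k) (s≤s z≤n)))
... | no x≢s₀ with ∑-mult-singleton x (λ k → s (suc k)) L (λ k l k<l → s↑ (suc k) (suc l) (s≤s k<l))
... | count≤1 , count*s₁≤x =
  subst (λ c → c ≤ 1 × c * s 0 ≤ x) (sym (cong (_+ rest) (mult-replicate-≢ 1 x≢s₀)))
    (count≤1 , ℕₚ.≤-trans (ℕₚ.*-monoʳ-≤ rest (ℕₚ.<⇒≤ (s↑ 0 1 (s≤s z≤n)))) count*s₁≤x)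
  where
  rest : ℕ
  rest = ∑[ k < L ] mult (x ∷ []) (s (suc k))

∑-mult-∷ : ∀ x xs (s : ℕ → ℕ) L →
  ∑[ k < L ] mult (x ∷ xs) (s k) ≡ ∑[ k < L ] mult (x ∷ []) (s k) + ∑[ k < L ] mult xs (s k)
∑-mult-∷ x xs s L = trans (∑-cong L λ k _ → mult-++ (x ∷ []) xs (s k)) (∑-+ _ _ L)

∑-mult≤length : ∀ xs (s : ℕ → ℕ) L → StrictlyIncreasing s → ∑[ k < L ] mult xs (s k) ≤ length xs
∑-mult≤length []       s L _  = ℕₚ.≤-reflexive (∑-zero _ L λ _ → refl)
∑-mult≤length (x ∷ xs) s L s↑ = ℕₚ.≤-trans (ℕₚ.≤-reflexive (∑-mult-∷ x xs s L))
  (ℕₚ.+-mono-≤ (proj₁ (∑-mult-singleton x s L s↑)) (∑-mult≤length xs s L s↑))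

∑-mult*s₀≤sum : ∀ xs (s : ℕ → ℕ) L → StrictlyIncreasing s → (∑[ k < L ] mult xs (s k)) * s 0 ≤ sum xs
∑-mult*s₀≤sum []       s L _  = ℕₚ.≤-reflexive (cong (_* s 0) (∑-zero _ L λ _ → refl))
∑-mult*s₀≤sum (x ∷ xs) s L s↑ = begin
  (∑[ k < L ] mult (x ∷ xs) (s k)) * s 0
    ≡⟨ cong (_* s 0) (∑-mult-∷ x xs s L) ⟩
  (∑[ k < L ] mult (x ∷ []) (s k) + ∑[ k < L ] mult xs (s k)) * s 0
    ≡⟨ ℕₚ.*-distribʳ-+ (s 0) (∑[ k < L ] mult (x ∷ []) (s k)) _ ⟩
  (∑[ k < L ] mult (x ∷ []) (s k)) * s 0 + (∑[ k < L ] mult xs (s k)) * s 0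
    ≤⟨ ℕₚ.+-mono-≤ (proj₂ (∑-mult-singleton x s L s↑)) (∑-mult*s₀≤sum xs s L s↑) ⟩
  x + sum xs
    ∎
  where open ℕₚ.≤-Reasoning

m*n≤o⇒m≤o/n : ∀ m n {o} .{{_ : NonZero n}} → m * n ≤ o → m ≤ o / n
m*n≤o⇒m≤o/n m n mn≤o = subst (_≤ _ / n) (m*n/n≡m m n) (/-monoˡ-≤ n mn≤o)

sum-replicate : ∀ m v → sum (replicate m v) ≡ m * v
sum-replicate zero    v = refl
sum-replicate (suc m) v = cong (λ s → v + s) (sum-replicate m v)

length≤sum : ∀ {xs} → All (1 ≤_) xs → length xs ≤ sum xs
length≤sum []         = z≤n
length≤sum (1≤x ∷ xs) = ℕₚ.+-mono-≤ 1≤x (length≤sum xs)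

length≡sum⇒ones : ∀ {xs} → All (1 ≤_) xs → length xs ≡ sum xs → xs ≡ replicate (length xs) 1
length≡sum⇒ones []                        _   = refl
length≡sum⇒ones {x ∷ xs} (1≤x ∷ 1≤xs) len≡sum with ℕₚ.m≤n⇒m<n∨m≡n 1≤x
... | inj₂ 1≡x = cong₂ _∷_ (sym 1≡x)
  (length≡sum⇒ones 1≤xs (ℕₚ.suc-injective (trans len≡sum (cong (_+ sum xs) (sym 1≡x)))))
... | inj₁ 1<x = ⊥-elim (ℕₚ.<-irrefl len≡sum (ℕₚ.+-mono-<-≤ 1<x (length≤sum 1≤xs)))

Linked-replicate-++ : ∀ m v {ys} → All (_≤ v) ys → Linked _≥_ ys → Linked _≥_ (replicate m v ++ ys)
Linked-replicate-++ zero          v _           ys↓ = ys↓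
Linked-replicate-++ (suc zero)    v []          _   = [-]
Linked-replicate-++ (suc zero)    v (y≤v ∷ _)   ys↓ = y≤v ∷ ys↓
Linked-replicate-++ (suc (suc m)) v ys≤v        ys↓ = ℕₚ.≤-refl ∷ Linked-replicate-++ (suc m) v ys≤v ys↓

Linked-replicate : ∀ m v → Linked _≥_ (replicate m v)
Linked-replicate m v = subst (Linked _≥_) (++-identityʳ (replicate m v)) (Linked-replicate-++ m v [] [])

powers-of-3-positive : ∀ {xs} → All IsPowerOf3 xs → All (1 ≤_) xs
powers-of-3-positive = All.map λ { (k , refl) → ℕₚ.m^n>0 3 k }

-- The 3-adic valuation of n!

module Valuation₃ where
  open import Data.Nat.Divisibility
  open import Data.Nat.DivMod
  open import Data.Nat.Primality using (Prime; prime?; euclidsLemma)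
  open import Data.Nat.Induction using (<-rec)
  open import Relation.Nullary.Decidable using (toWitness)
  open import Data.Unit using (tt)

  3^-∣-mono : ∀ {a b} → a ≤ b → 3 ^ a ∣ 3 ^ b
  3^-∣-mono {a} {b} a≤b = divides (3 ^ (b ∸ a))
    (trans (cong (3 ^_) (sym (ℕₚ.m∸n+n≡m a≤b))) (ℕₚ.^-distribˡ-+-* 3 (b ∸ a) a))

  IsV3-unique : ∀ {M} e e′ → IsV3 M e → IsV3 M e′ → e ≡ e′
  IsV3-unique e e′ (3ᵉ∣M , 3ᵉ⁺¹∤M) (3ᵉ′∣M , 3ᵉ′⁺¹∤M) with ℕₚ.<-cmp e e′
  ... | tri< e<e′ _ _ = ⊥-elim (3ᵉ⁺¹∤M (∣-trans (3^-∣-mono e<e′) 3ᵉ′∣M))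
  ... | tri≈ _ e≡e′ _ = e≡e′
  ... | tri> _ _ e′<e = ⊥-elim (3ᵉ′⁺¹∤M (∣-trans (3^-∣-mono e′<e) 3ᵉ∣M))

  IsV3-intro : ∀ {q} e → ¬ (3 ∣ q) → IsV3 (q * 3 ^ e) e
  IsV3-intro {q} e 3∤q = n∣m*n q , λ 3ᵉ⁺¹∣q3ᵉ → 3∤q (*-cancelʳ-∣ (3 ^ e) {{ℕₚ.m^n≢0 3 e}} 3ᵉ⁺¹∣q3ᵉ)

  IsV3-elim : ∀ {M} e → IsV3 M e → Σ ℕ λ q → (M ≡ q * 3 ^ e) × ¬ (3 ∣ q)
  IsV3-elim e (divides q M≡q3ᵉ , 3ᵉ⁺¹∤M) =
    q , M≡q3ᵉ , λ 3∣q → 3ᵉ⁺¹∤M (subst (3 ^ suc e ∣_) (sym M≡q3ᵉ) (*-monoˡ-∣ (3 ^ e) 3∣q))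

  3∤1 : ¬ (3 ∣ 1)
  3∤1 = >⇒∤ (s≤s (s≤s z≤n))

  IsV3-3 : IsV3 3 1
  IsV3-3 = IsV3-intro 1 3∤1

  3-prime : Prime 3
  3-prime = toWitness {a? = prime? 3} tt

  IsV3-* : ∀ {a b} e₁ e₂ → IsV3 a e₁ → IsV3 b e₂ → IsV3 (a * b) (e₁ + e₂)
  IsV3-* {a} {b} e₁ e₂ v₁ v₂ with IsV3-elim e₁ v₁ | IsV3-elim e₂ v₂
  ... | q₁ , a≡ , 3∤q₁ | q₂ , b≡ , 3∤q₂ =
    subst (λ m → IsV3 m (e₁ + e₂)) (sym ab≡) (IsV3-intro (e₁ + e₂) 3∤q₁q₂)
    where
    3∤q₁q₂ : ¬ (3 ∣ q₁ * q₂)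
    3∤q₁q₂ 3∣q₁q₂ with euclidsLemma q₁ q₂ 3-prime 3∣q₁q₂
    ... | inj₁ 3∣q₁ = 3∤q₁ 3∣q₁
    ... | inj₂ 3∣q₂ = 3∤q₂ 3∣q₂
    ab≡ : a * b ≡ q₁ * q₂ * 3 ^ (e₁ + e₂)
    ab≡ = trans (cong₂ _*_ a≡ b≡) (trans (regroup q₁ q₂ (3 ^ e₁) (3 ^ e₂))
                 (cong (q₁ * q₂ *_) (sym (ℕₚ.^-distribˡ-+-* 3 e₁ e₂))))
      where
      regroup : ∀ x y u v → (x * u) * (y * v) ≡ (x * y) * (u * v)
      regroup = ℕ-solve-∀

  IsV3-exists : ∀ m → Σ ℕ (IsV3 (suc m))
  IsV3-exists = <-rec _ step
    where
    step : ∀ m → (∀ {k} → k < m → Σ ℕ (IsV3 (suc k))) → Σ ℕ (IsV3 (suc m))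
    step m rec with 3 ∣? suc m
    ... | no 3∤m+1 = 0 , subst (λ x → IsV3 x 0) (ℕₚ.*-identityʳ (suc m)) (IsV3-intro 0 3∤m+1)
    ... | yes (divides (suc k) m+1≡) with rec k<m
      where
      k<m : k < m
      k<m = ℕₚ.≤-pred (subst (suc (suc k) ≤_) (sym m+1≡) (s≤s (s≤s (ℕₚ.m≤n⇒m≤1+n (ℕₚ.m≤m*n k 3)))))
    ... | t , vₜ = suc t , subst (λ x → IsV3 x (suc t)) (sym m+1≡)
                     (subst (IsV3 (suc k * 3)) (ℕₚ.+-comm t 1) (IsV3-* t 1 vₜ IsV3-3))

  n<3^n : ∀ n → n < 3 ^ n
  n<3^n zero    = s≤s z≤n
  n<3^n (suc n) = ℕₚ.<-≤-trans (s≤s (n<3^n n))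
    (subst (suc (3 ^ n) ≤_) (ℕₚ.*-comm (3 ^ n) 3) (ℕₚ.m<m*n (3 ^ n) 3 {{ℕₚ.m^n≢0 3 n}} (s≤s (s≤s z≤n))))

  suc-/ : ∀ m q .{{_ : NonZero q}} →
    (q ∣ suc m × suc m / q ≡ suc (m / q)) ⊎ (¬ (q ∣ suc m) × suc m / q ≡ m / q)
  suc-/ m q with ℕₚ.m≤n⇒m<n∨m≡n (m%n<n m q)
  ... | inj₁ 1+r<q = inj₂ (q∤m+1 , m+1/q≡m/q)
    where
    m+1≡ : suc m ≡ suc (m % q) + m / q * q
    m+1≡ = cong suc (m≡m%n+[m/n]*n m q)
    m+1/q≡m/q : suc m / q ≡ m / q
    m+1/q≡m/q = begin
      suc m / q                        ≡⟨ /-congˡ m+1≡ ⟩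
      (suc (m % q) + m / q * q) / q    ≡⟨ +-distrib-/-∣ʳ (suc (m % q)) (n∣m*n (m / q)) ⟩
      suc (m % q) / q + m / q * q / q  ≡⟨ cong₂ _+_ (m<n⇒m/n≡0 1+r<q) (m*n/n≡m (m / q) q) ⟩
      m / q                            ∎
      where open ≡-Reasoning
    q∤m+1 : ¬ (q ∣ suc m)
    q∤m+1 q∣m+1 =
      >⇒∤ 1+r<q (∣m+n∣m⇒∣n (subst (q ∣_) (trans m+1≡ (ℕₚ.+-comm _ (m / q * q))) q∣m+1) (n∣m*n (m / q)))
  ... | inj₂ 1+r≡q = inj₁ (divides (suc (m / q)) m+1≡ , trans (/-congˡ m+1≡) (m*n/n≡m (suc (m / q)) q))
    where
    m+1≡ : suc m ≡ suc (m / q) * q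
    m+1≡ = trans (cong suc (m≡m%n+[m/n]*n m q)) (cong (_+ m / q * q) 1+r≡q)

  legendre-sum : ℕ → ℕ
  legendre-sum n = ∑[ j < n ] div3^ n (suc j)

  legendre : ∀ n → IsV3 (n !) (legendre-sum n)
  legendre zero    = IsV3-intro 0 3∤1
  legendre (suc m) with IsV3-exists m
  ... | t , vₜ = subst (IsV3 (suc m !)) (sym legendre-sum-suc) (IsV3-* t (legendre-sum m) vₜ (legendre m))
    where
    3ᵗ∣m+1 : 3 ^ t ∣ suc m
    3ᵗ∣m+1 = proj₁ vₜ
    3ᵗ⁺¹∤m+1 : ¬ (3 ^ suc t ∣ suc m)
    3ᵗ⁺¹∤m+1 = proj₂ vₜ
    t≤m+1 : t ≤ suc m
    t≤m+1 = ℕₚ.<⇒≤ (ℕₚ.<-≤-trans (n<3^n t) (∣⇒≤ 3ᵗ∣m+1))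
    term-below : ∀ j → j < t → div3^ (suc m) (suc j) ≡ suc (div3^ m (suc j))
    term-below j j<t with suc-/ m (3 ^ suc j) {{ℕₚ.m^n≢0 3 (suc j)}}
    ... | inj₁ (_ , eq) = eq
    ... | inj₂ (3ʲ⁺¹∤m+1 , _) = ⊥-elim (3ʲ⁺¹∤m+1 (∣-trans (3^-∣-mono j<t) 3ᵗ∣m+1))
    term-above : ∀ j → t ≤ j → div3^ (suc m) (suc j) ≡ div3^ m (suc j)
    term-above j t≤j with suc-/ m (3 ^ suc j) {{ℕₚ.m^n≢0 3 (suc j)}}
    ... | inj₁ (3ʲ⁺¹∣m+1 , _) = ⊥-elim (3ᵗ⁺¹∤m+1 (∣-trans (3^-∣-mono (s≤s t≤j)) 3ʲ⁺¹∣m+1))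
    ... | inj₂ (_ , eq) = eq
    last≡0 : div3^ m (suc m) ≡ 0
    last≡0 = m<n⇒m/n≡0 {{ℕₚ.m^n≢0 3 (suc m)}} (ℕₚ.<-trans (ℕₚ.n<1+n m) (n<3^n (suc m)))
    legendre-sum-suc : legendre-sum (suc m) ≡ t + legendre-sum m
    legendre-sum-suc = begin
      ∑[ j < suc m ] div3^ (suc m) (suc j)  ≡⟨ ∑-+-prefix _ _ (suc m) t t≤m+1 term-below term-above ⟩
      ∑[ j < suc m ] div3^ m (suc j) + t    ≡⟨ cong (_+ t) (∑-snoc (λ j → div3^ m (suc j)) m) ⟩
      legendre-sum m + div3^ m (suc m) + t  ≡⟨ cong (λ x → legendre-sum m + x + t) last≡0 ⟩
      legendre-sum m + 0 + t                ≡⟨ cong (_+ t) (ℕₚ.+-identityʳ (legendre-sum m)) ⟩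
      legendre-sum m + t                    ≡⟨ ℕₚ.+-comm (legendre-sum m) t ⟩
      t + legendre-sum m                    ∎
      where open ≡-Reasoning

  IsV3-suc-! : ∀ {m} e → ¬ (3 ∣ suc m) → IsV3 (m !) e → IsV3 (suc m !) e
  IsV3-suc-! {m} e 3∤m+1 = IsV3-* 0 e (subst (λ x → IsV3 x 0) (ℕₚ.*-identityʳ (suc m)) (IsV3-intro 0 3∤m+1))

  3∤r+3n : ∀ n {r} → 0 < r → r < 3 → ¬ (3 ∣ r + 3 * n)
  3∤r+3n n {r} 0<r r<3 3∣r+3n =
    >⇒∤ {{ℕ.>-nonZero 0<r}} r<3 (∣m+n∣m⇒∣n (subst (3 ∣_) (ℕₚ.+-comm r (3 * n)) 3∣r+3n) (m∣m*n n))

  IsV3-3n+1 : ∀ n e → IsV3 ((3 * n) !) e → IsV3 ((3 * n + 1) !) e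
  IsV3-3n+1 n e v = subst (λ x → IsV3 (x !) e) (ℕₚ.+-comm 1 (3 * n))
    (IsV3-suc-! e (3∤r+3n n (s≤s z≤n) (s≤s (s≤s z≤n))) v)

  IsV3-3n+2 : ∀ n e → IsV3 ((3 * n) !) e → IsV3 ((3 * n + 2) !) e
  IsV3-3n+2 n e v = subst (λ x → IsV3 (x !) e) (ℕₚ.+-comm 2 (3 * n))
    (IsV3-suc-! e (3∤r+3n n (s≤s z≤n) ℕₚ.≤-refl) (IsV3-suc-! e (3∤r+3n n (s≤s z≤n) (s≤s (s≤s z≤n))) v))

open Valuation₃ using (n<3^n; legendre-sum; legendre; IsV3-unique; IsV3-3n+1; IsV3-3n+2)

-- The ring ℤ[x]

-- The coefficientwise equality of Defs is wrapped in a record so that the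
-- two polynomials can be inferred from a proof of p ≈ q.
infix 4 _≈_
record _≈_ (p q : Poly) : Set where
  constructor coeffwise
  field coeff≡ : p ≈ₚ q
open _≈_

≈-refl : ∀ {p} → p ≈ p
≈-refl = coeffwise λ _ → refl

≈-sym : ∀ {p q} → p ≈ q → q ≈ p
≈-sym p≈q = coeffwise λ i → sym (coeff≡ p≈q i)

≈-trans : ∀ {p q r} → p ≈ q → q ≈ r → p ≈ r
≈-trans p≈q q≈r = coeffwise λ i → trans (coeff≡ p≈q i) (coeff≡ q≈r i)

≈-reflexive : ∀ {p q} → p ≡ q → p ≈ q
≈-reflexive refl = ≈-refl

≈-isEquivalence : IsEquivalence _≈_
≈-isEquivalence = record { refl = ≈-refl ; sym = ≈-sym ; trans = ≈-trans }

≈-setoid : Setoid _ _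
≈-setoid = record { isEquivalence = ≈-isEquivalence }

module ≈-Reasoning = SetoidReasoning ≈-setoid

∷-cong : ∀ {a b p q} → a ≡ b → p ≈ q → (a ∷ p) ≈ (b ∷ q)
∷-cong a≡b p≈q = coeffwise λ { zero → a≡b ; (suc i) → coeff≡ p≈q i }

∷-injective : ∀ {a b p q} → (a ∷ p) ≈ (b ∷ q) → (a ≡ b) × (p ≈ q)
∷-injective e = coeff≡ e zero , coeffwise λ i → coeff≡ e (suc i)

0∷[]≈[] : (+ 0 ∷ []) ≈ []
0∷[]≈[] = coeffwise λ { zero → refl ; (suc i) → refl }

scale : ℤ → Poly → Poly
scale a = map (a ℤ.*_)

negₚ : Poly → Poly
negₚ = map (λ a → ℤ.- a)

coeff-+ₚ : ∀ p q i → coeff (p +ₚ q) i ≡ coeff p i ℤ.+ coeff q i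
coeff-+ₚ []      q       i       = sym (ℤₚ.+-identityˡ _)
coeff-+ₚ (a ∷ p) []      i       = sym (ℤₚ.+-identityʳ _)
coeff-+ₚ (a ∷ p) (b ∷ q) zero    = refl
coeff-+ₚ (a ∷ p) (b ∷ q) (suc i) = coeff-+ₚ p q i

coeff-scale : ∀ a q i → coeff (scale a q) i ≡ a ℤ.* coeff q i
coeff-scale a []      i       = sym (ℤₚ.*-zeroʳ a)
coeff-scale a (b ∷ q) zero    = refl
coeff-scale a (b ∷ q) (suc i) = coeff-scale a q i

coeff-negₚ : ∀ q i → coeff (negₚ q) i ≡ ℤ.- coeff q i
coeff-negₚ []      i       = refl
coeff-negₚ (b ∷ q) zero    = refl
coeff-negₚ (b ∷ q) (suc i) = coeff-negₚ q i

+ₚ-cong : ∀ {p p′ q q′} → p ≈ p′ → q ≈ q′ → (p +ₚ q) ≈ (p′ +ₚ q′)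
+ₚ-cong {p} {p′} {q} {q′} p≈p′ q≈q′ = coeffwise λ i → begin
  coeff (p +ₚ q) i           ≡⟨ coeff-+ₚ p q i ⟩
  coeff p i ℤ.+ coeff q i    ≡⟨ cong₂ ℤ._+_ (coeff≡ p≈p′ i) (coeff≡ q≈q′ i) ⟩
  coeff p′ i ℤ.+ coeff q′ i  ≡⟨ coeff-+ₚ p′ q′ i ⟨
  coeff (p′ +ₚ q′) i         ∎
  where open ≡-Reasoning

+ₚ-comm : ∀ p q → (p +ₚ q) ≈ (q +ₚ p)
+ₚ-comm p q = coeffwise λ i → begin
  coeff (p +ₚ q) i         ≡⟨ coeff-+ₚ p q i ⟩
  coeff p i ℤ.+ coeff q i  ≡⟨ ℤₚ.+-comm (coeff p i) _ ⟩
  coeff q i ℤ.+ coeff p i  ≡⟨ coeff-+ₚ q p i ⟨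
  coeff (q +ₚ p) i         ∎
  where open ≡-Reasoning

+ₚ-assoc : ∀ p q r → ((p +ₚ q) +ₚ r) ≈ (p +ₚ (q +ₚ r))
+ₚ-assoc p q r = coeffwise λ i → begin
  coeff ((p +ₚ q) +ₚ r) i                  ≡⟨ coeff-+ₚ (p +ₚ q) r i ⟩
  coeff (p +ₚ q) i ℤ.+ coeff r i           ≡⟨ cong (ℤ._+ coeff r i) (coeff-+ₚ p q i) ⟩
  (coeff p i ℤ.+ coeff q i) ℤ.+ coeff r i  ≡⟨ ℤₚ.+-assoc (coeff p i) _ _ ⟩
  coeff p i ℤ.+ (coeff q i ℤ.+ coeff r i)  ≡⟨ cong (λ t → coeff p i ℤ.+ t) (coeff-+ₚ q r i) ⟨
  coeff p i ℤ.+ coeff (q +ₚ r) i           ≡⟨ coeff-+ₚ p (q +ₚ r) i ⟨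
  coeff (p +ₚ (q +ₚ r)) i                  ∎
  where open ≡-Reasoning

+ₚ-interchange : ∀ p q r s → ((p +ₚ q) +ₚ (r +ₚ s)) ≈ ((p +ₚ r) +ₚ (q +ₚ s))
+ₚ-interchange p q r s = coeffwise λ i → begin
  coeff ((p +ₚ q) +ₚ (r +ₚ s)) i
    ≡⟨ trans (coeff-+ₚ (p +ₚ q) (r +ₚ s) i) (cong₂ ℤ._+_ (coeff-+ₚ p q i) (coeff-+ₚ r s i)) ⟩
  (coeff p i ℤ.+ coeff q i) ℤ.+ (coeff r i ℤ.+ coeff s i)
    ≡⟨ ℤ-+-interchange (coeff p i) (coeff q i) (coeff r i) (coeff s i) ⟩
  (coeff p i ℤ.+ coeff r i) ℤ.+ (coeff q i ℤ.+ coeff s i)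
    ≡⟨ trans (coeff-+ₚ (p +ₚ r) (q +ₚ s) i) (cong₂ ℤ._+_ (coeff-+ₚ p r i) (coeff-+ₚ q s i)) ⟨
  coeff ((p +ₚ r) +ₚ (q +ₚ s)) i
    ∎
  where open ≡-Reasoning

+ₚ-identityʳ : ∀ p → (p +ₚ []) ≈ p
+ₚ-identityʳ []      = ≈-refl
+ₚ-identityʳ (a ∷ p) = ≈-refl

+ₚ-inverseʳ : ∀ p → (p +ₚ negₚ p) ≈ []
+ₚ-inverseʳ p = coeffwise λ i → begin
  coeff (p +ₚ negₚ p) i           ≡⟨ coeff-+ₚ p (negₚ p) i ⟩
  coeff p i ℤ.+ coeff (negₚ p) i  ≡⟨ cong (λ t → coeff p i ℤ.+ t) (coeff-negₚ p i) ⟩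
  coeff p i ℤ.+ ℤ.- coeff p i     ≡⟨ ℤₚ.+-inverseʳ (coeff p i) ⟩
  + 0                             ∎
  where open ≡-Reasoning

negₚ-cong : ∀ {p q} → p ≈ q → negₚ p ≈ negₚ q
negₚ-cong {p} {q} p≈q = coeffwise λ i →
  trans (coeff-negₚ p i) (trans (cong ℤ.-_ (coeff≡ p≈q i)) (sym (coeff-negₚ q i)))

scale-congʳ : ∀ a {p q} → p ≈ q → scale a p ≈ scale a q
scale-congʳ a {p} {q} p≈q = coeffwise λ i →
  trans (coeff-scale a p i) (trans (cong (a ℤ.*_) (coeff≡ p≈q i)) (sym (coeff-scale a q i)))

scale-zero : ∀ q → scale (+ 0) q ≈ []
scale-zero q = coeffwise λ i → trans (coeff-scale (+ 0) q i) (ℤₚ.*-zeroˡ (coeff q i))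

scale-one : ∀ q → scale (+ 1) q ≈ q
scale-one q = coeffwise λ i → trans (coeff-scale (+ 1) q i) (ℤₚ.*-identityˡ _)

scale-distribʳ : ∀ a b q → scale (a ℤ.+ b) q ≈ (scale a q +ₚ scale b q)
scale-distribʳ a b q = coeffwise λ i → begin
  coeff (scale (a ℤ.+ b) q) i                  ≡⟨ coeff-scale (a ℤ.+ b) q i ⟩
  (a ℤ.+ b) ℤ.* coeff q i                      ≡⟨ ℤₚ.*-distribʳ-+ (coeff q i) a b ⟩
  a ℤ.* coeff q i ℤ.+ b ℤ.* coeff q i          ≡⟨ cong₂ ℤ._+_ (coeff-scale a q i) (coeff-scale b q i) ⟨
  coeff (scale a q) i ℤ.+ coeff (scale b q) i  ≡⟨ coeff-+ₚ (scale a q) (scale b q) i ⟨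
  coeff (scale a q +ₚ scale b q) i             ∎
  where open ≡-Reasoning

scale-distribˡ : ∀ a q r → scale a (q +ₚ r) ≈ (scale a q +ₚ scale a r)
scale-distribˡ a q r = coeffwise λ i → begin
  coeff (scale a (q +ₚ r)) i                   ≡⟨ coeff-scale a (q +ₚ r) i ⟩
  a ℤ.* coeff (q +ₚ r) i                       ≡⟨ cong (a ℤ.*_) (coeff-+ₚ q r i) ⟩
  a ℤ.* (coeff q i ℤ.+ coeff r i)              ≡⟨ ℤₚ.*-distribˡ-+ a (coeff q i) _ ⟩
  a ℤ.* coeff q i ℤ.+ a ℤ.* coeff r i          ≡⟨ cong₂ ℤ._+_ (coeff-scale a q i) (coeff-scale a r i) ⟨
  coeff (scale a q) i ℤ.+ coeff (scale a r) i  ≡⟨ coeff-+ₚ (scale a q) (scale a r) i ⟨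
  coeff (scale a q +ₚ scale a r) i             ∎
  where open ≡-Reasoning

scale-scale : ∀ a b r → scale a (scale b r) ≈ scale (a ℤ.* b) r
scale-scale a b r = coeffwise λ i → begin
  coeff (scale a (scale b r)) i  ≡⟨ coeff-scale a (scale b r) i ⟩
  a ℤ.* coeff (scale b r) i      ≡⟨ cong (a ℤ.*_) (coeff-scale b r i) ⟩
  a ℤ.* (b ℤ.* coeff r i)        ≡⟨ ℤₚ.*-assoc a b _ ⟨
  a ℤ.* b ℤ.* coeff r i          ≡⟨ coeff-scale (a ℤ.* b) r i ⟨
  coeff (scale (a ℤ.* b) r) i    ∎
  where open ≡-Reasoning

scale-0∷ : ∀ a p → scale a (+ 0 ∷ p) ≈ (+ 0 ∷ scale a p)
scale-0∷ a p = ∷-cong (ℤₚ.*-zeroʳ a) ≈-refl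

*ₚ-zeroˡ : ∀ {p} q → p ≈ [] → (p *ₚ q) ≈ []
*ₚ-zeroˡ {[]}    q _   = ≈-refl
*ₚ-zeroˡ {a ∷ p} q a∷p≈[] =
  +ₚ-cong (≈-trans (≈-reflexive (cong (λ c → scale c q) (coeff≡ a∷p≈[] zero))) (scale-zero q))
          (≈-trans (∷-cong refl (*ₚ-zeroˡ {p} q (coeffwise λ i → coeff≡ a∷p≈[] (suc i)))) 0∷[]≈[])

*ₚ-zeroʳ : ∀ q → (q *ₚ []) ≈ []
*ₚ-zeroʳ []      = ≈-refl
*ₚ-zeroʳ (b ∷ q) = ≈-trans (∷-cong refl (*ₚ-zeroʳ q)) 0∷[]≈[]

*ₚ-congˡ : ∀ {p p′} q → p ≈ p′ → (p *ₚ q) ≈ (p′ *ₚ q)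
*ₚ-congˡ {[]}    {p′}     q p≈p′ = ≈-sym (*ₚ-zeroˡ q (≈-sym p≈p′))
*ₚ-congˡ {a ∷ p} {[]}     q p≈p′ = *ₚ-zeroˡ q p≈p′
*ₚ-congˡ {a ∷ p} {b ∷ p′} q p≈p′ =
  let a≡b , p≈p′ = ∷-injective p≈p′ in
  +ₚ-cong (≈-reflexive (cong (λ c → scale c q) a≡b)) (∷-cong refl (*ₚ-congˡ q p≈p′))

*ₚ-congʳ : ∀ p {q q′} → q ≈ q′ → (p *ₚ q) ≈ (p *ₚ q′)
*ₚ-congʳ []      q≈q′ = ≈-refl
*ₚ-congʳ (a ∷ p) q≈q′ = +ₚ-cong (scale-congʳ a q≈q′) (∷-cong refl (*ₚ-congʳ p q≈q′))

*ₚ-cong : ∀ {p p′ q q′} → p ≈ p′ → q ≈ q′ → (p *ₚ q) ≈ (p′ *ₚ q′)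
*ₚ-cong {p′ = p′} {q = q} p≈p′ q≈q′ = ≈-trans (*ₚ-congˡ q p≈p′) (*ₚ-congʳ p′ q≈q′)

*ₚ-distribʳ : ∀ q p p′ → ((p +ₚ p′) *ₚ q) ≈ ((p *ₚ q) +ₚ (p′ *ₚ q))
*ₚ-distribʳ q []      p′       = ≈-refl
*ₚ-distribʳ q (a ∷ p) []       = ≈-sym (+ₚ-identityʳ _)
*ₚ-distribʳ q (a ∷ p) (b ∷ p′) =
  ≈-trans (+ₚ-cong (scale-distribʳ a b q) (∷-cong refl (*ₚ-distribʳ q p p′)))
          (+ₚ-interchange (scale a q) (scale b q) (+ 0 ∷ p *ₚ q) (+ 0 ∷ p′ *ₚ q))

*ₚ-distribˡ : ∀ p q q′ → (p *ₚ (q +ₚ q′)) ≈ ((p *ₚ q) +ₚ (p *ₚ q′))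
*ₚ-distribˡ []      q q′ = ≈-refl
*ₚ-distribˡ (a ∷ p) q q′ =
  ≈-trans (+ₚ-cong (scale-distribˡ a q q′) (∷-cong refl (*ₚ-distribˡ p q q′)))
          (+ₚ-interchange (scale a q) (scale a q′) (+ 0 ∷ p *ₚ q) (+ 0 ∷ p *ₚ q′))

scale-*ₚ : ∀ a q r → (scale a q *ₚ r) ≈ scale a (q *ₚ r)
scale-*ₚ a []      r = ≈-refl
scale-*ₚ a (b ∷ q) r =
  ≈-trans (+ₚ-cong (≈-sym (scale-scale a b r))
                   (≈-trans (∷-cong refl (scale-*ₚ a q r)) (≈-sym (scale-0∷ a (q *ₚ r)))))
          (≈-sym (scale-distribˡ a (scale b r) (+ 0 ∷ q *ₚ r)))

*ₚ-assoc : ∀ p q r → ((p *ₚ q) *ₚ r) ≈ (p *ₚ (q *ₚ r))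
*ₚ-assoc []      q r = ≈-refl
*ₚ-assoc (a ∷ p) q r =
  ≈-trans (*ₚ-distribʳ r (scale a q) (+ 0 ∷ p *ₚ q))
          (+ₚ-cong (scale-*ₚ a q r) (+ₚ-cong (scale-zero r) (∷-cong refl (*ₚ-assoc p q r))))

*ₚ-identityˡ : ∀ p → (oneₚ *ₚ p) ≈ p
*ₚ-identityˡ p = ≈-trans (+ₚ-cong (scale-one p) 0∷[]≈[]) (+ₚ-identityʳ p)

*ₚ-constʳ : ∀ q a → (q *ₚ (a ∷ [])) ≈ scale a q
*ₚ-constʳ []      a = ≈-refl
*ₚ-constʳ (b ∷ q) a = ∷-cong (trans (ℤₚ.+-identityʳ _) (ℤₚ.*-comm b a)) (*ₚ-constʳ q a)

*ₚ-0∷ : ∀ q p → (q *ₚ (+ 0 ∷ p)) ≈ (+ 0 ∷ q *ₚ p)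
*ₚ-0∷ []      p = ≈-sym 0∷[]≈[]
*ₚ-0∷ (b ∷ q) p = ∷-cong (trans (ℤₚ.+-identityʳ _) (ℤₚ.*-zeroʳ b)) (+ₚ-cong ≈-refl (*ₚ-0∷ q p))

*ₚ-comm : ∀ p q → (p *ₚ q) ≈ (q *ₚ p)
*ₚ-comm []      q = ≈-sym (*ₚ-zeroʳ q)
*ₚ-comm (a ∷ p) q = begin
  scale a q +ₚ (+ 0 ∷ p *ₚ q)          ≈⟨ +ₚ-cong (≈-sym (*ₚ-constʳ q a)) (∷-cong refl (*ₚ-comm p q)) ⟩
  (q *ₚ (a ∷ [])) +ₚ (+ 0 ∷ q *ₚ p)    ≈⟨ +ₚ-cong ≈-refl (≈-sym (*ₚ-0∷ q p)) ⟩
  (q *ₚ (a ∷ [])) +ₚ (q *ₚ (+ 0 ∷ p))  ≈⟨ ≈-sym (*ₚ-distribˡ q (a ∷ []) (+ 0 ∷ p)) ⟩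
  q *ₚ ((a ℤ.+ + 0) ∷ p)               ≈⟨ *ₚ-congʳ q (∷-cong (ℤₚ.+-identityʳ a) ≈-refl) ⟩
  q *ₚ (a ∷ p)                         ∎
  where open ≈-Reasoning

*ₚ-identityʳ : ∀ p → (p *ₚ oneₚ) ≈ p
*ₚ-identityʳ p = ≈-trans (*ₚ-comm p oneₚ) (*ₚ-identityˡ p)

ℤ[x]-isCommutativeRing : IsCommutativeRing _≈_ _+ₚ_ _*ₚ_ negₚ [] oneₚ
ℤ[x]-isCommutativeRing = record
  { isRing = record
    { +-isAbelianGroup = record
      { isGroup = record
        { isMonoid = record
          { isSemigroup = record
            { isMagma = record { isEquivalence = ≈-isEquivalence ; ∙-cong = +ₚ-cong }
            ; assoc = +ₚ-assoc }
          ; identity = (λ _ → ≈-refl) , +ₚ-identityʳ }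
        ; inverse = (λ p → ≈-trans (+ₚ-comm (negₚ p) p) (+ₚ-inverseʳ p)) , +ₚ-inverseʳ
        ; ⁻¹-cong = negₚ-cong }
      ; comm = +ₚ-comm }
    ; *-cong = *ₚ-cong
    ; *-assoc = *ₚ-assoc
    ; *-identity = *ₚ-identityˡ , *ₚ-identityʳ
    ; distrib = *ₚ-distribˡ , *ₚ-distribʳ }
  ; *-comm = *ₚ-comm }

ℤ[x] : CommutativeRing _ _
ℤ[x] = record { isCommutativeRing = ℤ[x]-isCommutativeRing }

-- The ring solver must recognise zero constants: otherwise zero coefficients are not
-- dropped from its normal forms, and the two sides of an identity need not coincide.
isZero? : ∀ p → Maybe ([] ≈ p)
isZero? []        = just ≈-refl
isZero? (+ 0 ∷ p) with isZero? p
... | just []≈p = just (coeffwise λ { zero → refl ; (suc i) → coeff≡ []≈p i })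
... | nothing   = nothing
isZero? (_ ∷ _)   = nothing

ℤ[x]-almostCommutativeRing : ACR.AlmostCommutativeRing _ _
ℤ[x]-almostCommutativeRing = ACR.fromCommutativeRing ℤ[x] isZero?

open import Algebra.Properties.Monoid.Divisibility (CommutativeRing.*-monoid ℤ[x])
  using (_∣_; _,_; ∣ʳ-refl; ∣ʳ-respʳ-≈)
open import Algebra.Properties.CommutativeSemigroup (CommutativeRing.*-commutativeSemigroup ℤ[x])
  using () renaming (interchange to *ₚ-interchange)

constₚ : ℤ → Poly
constₚ a = a ∷ []

constₚ-*ₚ : ∀ a b → (constₚ a *ₚ constₚ b) ≈ constₚ (a ℤ.* b)
constₚ-*ₚ a b = ∷-cong (ℤₚ.+-identityʳ _) ≈-refl

*ₚ-constˡ : ∀ a q → (constₚ a *ₚ q) ≈ scale a q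
*ₚ-constˡ a q = ≈-trans (+ₚ-cong ≈-refl 0∷[]≈[]) (+ₚ-identityʳ _)

^ₚ-cong : ∀ {p q} k → p ≈ q → (p ^ₚ k) ≈ (q ^ₚ k)
^ₚ-cong zero    p≈q = ≈-refl
^ₚ-cong (suc k) p≈q = *ₚ-cong p≈q (^ₚ-cong k p≈q)

^ₚ-congʳ : ∀ p {k l} → k ≡ l → (p ^ₚ k) ≈ (p ^ₚ l)
^ₚ-congʳ p refl = ≈-refl

^ₚ-+ : ∀ p k l → (p ^ₚ (k + l)) ≈ ((p ^ₚ k) *ₚ (p ^ₚ l))
^ₚ-+ p zero    l = ≈-sym (*ₚ-identityˡ _)
^ₚ-+ p (suc k) l = ≈-trans (*ₚ-congʳ p (^ₚ-+ p k l)) (≈-sym (*ₚ-assoc p (p ^ₚ k) (p ^ₚ l)))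

^ₚ-distrib-*ₚ : ∀ p q k → ((p *ₚ q) ^ₚ k) ≈ ((p ^ₚ k) *ₚ (q ^ₚ k))
^ₚ-distrib-*ₚ p q zero    = ≈-sym (*ₚ-identityˡ oneₚ)
^ₚ-distrib-*ₚ p q (suc k) =
  ≈-trans (*ₚ-congʳ (p *ₚ q) (^ₚ-distrib-*ₚ p q k)) (*ₚ-interchange p q (p ^ₚ k) (q ^ₚ k))

monomial-+ : ∀ k l → monomial (k + l) ≈ (monomial k *ₚ monomial l)
monomial-+ zero    l = ≈-sym (*ₚ-identityˡ _)
monomial-+ (suc k) l = ≈-trans (∷-cong refl (monomial-+ k l)) (≈-sym (+ₚ-cong (scale-zero _) ≈-refl))

eval-≈[] : ∀ {p} t → p ≈ [] → eval p t ≡ + 0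
eval-≈[] {[]}    t _ = refl
eval-≈[] {a ∷ p} t a∷p≈[] = begin
  a ℤ.+ t ℤ.* eval p t    ≡⟨ cong₂ (λ b e → b ℤ.+ t ℤ.* e) (coeff≡ a∷p≈[] zero)
                                   (eval-≈[] {p} t (coeffwise λ i → coeff≡ a∷p≈[] (suc i))) ⟩
  + 0 ℤ.+ t ℤ.* + 0  ≡⟨ cong (λ e → + 0 ℤ.+ e) (ℤₚ.*-zeroʳ t) ⟩
  + 0                ∎
  where open ≡-Reasoning

eval-cong : ∀ {p q} t → p ≈ q → eval p t ≡ eval q t
eval-cong {[]}    {q}     t p≈q = sym (eval-≈[] t (≈-sym p≈q))
eval-cong {a ∷ p} {[]}    t p≈q = eval-≈[] t p≈q
eval-cong {a ∷ p} {b ∷ q} t p≈q =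
  let a≡b , p≈q = ∷-injective p≈q in cong₂ (λ c e → c ℤ.+ t ℤ.* e) a≡b (eval-cong t p≈q)

eval-+ₚ : ∀ p q t → eval (p +ₚ q) t ≡ eval p t ℤ.+ eval q t
eval-+ₚ []      q       t = sym (ℤₚ.+-identityˡ _)
eval-+ₚ (a ∷ p) []      t = sym (ℤₚ.+-identityʳ _)
eval-+ₚ (a ∷ p) (b ∷ q) t =
  trans (cong (λ e → (a ℤ.+ b) ℤ.+ t ℤ.* e) (eval-+ₚ p q t)) (ℤ-solve a b t (eval p t) (eval q t))
  where
  ℤ-solve : ∀ a b t e f → (a ℤ.+ b) ℤ.+ t ℤ.* (e ℤ.+ f) ≡ (a ℤ.+ t ℤ.* e) ℤ.+ (b ℤ.+ t ℤ.* f)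
  ℤ-solve = ℤ-solve-∀

eval-scale : ∀ a q t → eval (scale a q) t ≡ a ℤ.* eval q t
eval-scale a []      t = sym (ℤₚ.*-zeroʳ a)
eval-scale a (b ∷ q) t =
  trans (cong (λ e → a ℤ.* b ℤ.+ t ℤ.* e) (eval-scale a q t)) (ℤ-solve a b t (eval q t))
  where
  ℤ-solve : ∀ a b t e → a ℤ.* b ℤ.+ t ℤ.* (a ℤ.* e) ≡ a ℤ.* (b ℤ.+ t ℤ.* e)
  ℤ-solve = ℤ-solve-∀

eval-*ₚ : ∀ p q t → eval (p *ₚ q) t ≡ eval p t ℤ.* eval q t
eval-*ₚ []      q t = refl
eval-*ₚ (a ∷ p) q t = begin
  eval (scale a q +ₚ (+ 0 ∷ p *ₚ q)) t                    ≡⟨ eval-+ₚ (scale a q) _ t ⟩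
  eval (scale a q) t ℤ.+ (+ 0 ℤ.+ t ℤ.* eval (p *ₚ q) t)  ≡⟨ cong₂ (λ e f → e ℤ.+ (+ 0 ℤ.+ t ℤ.* f))
                                                                 (eval-scale a q t) (eval-*ₚ p q t) ⟩
  a ℤ.* eval q t ℤ.+ (+ 0 ℤ.+ t ℤ.* (eval p t ℤ.* eval q t))  ≡⟨ ℤ-solve a t (eval p t) (eval q t) ⟩
  (a ℤ.+ t ℤ.* eval p t) ℤ.* eval q t                         ∎
  where
  open ≡-Reasoning
  ℤ-solve : ∀ a t e f → a ℤ.* f ℤ.+ (+ 0 ℤ.+ t ℤ.* (e ℤ.* f)) ≡ (a ℤ.+ t ℤ.* e) ℤ.* f
  ℤ-solve = ℤ-solve-∀

eval-constₚ : ∀ a t → eval (constₚ a) t ≡ a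
eval-constₚ a t = trans (cong (λ e → a ℤ.+ e) (ℤₚ.*-zeroʳ t)) (ℤₚ.+-identityʳ a)

eval-^ₚ : ∀ p k t {b} → eval p t ≡ + b → eval (p ^ₚ k) t ≡ + (b ^ k)
eval-^ₚ p zero    t     _       = eval-constₚ (+ 1) t
eval-^ₚ p (suc k) t {b} p[t]≡b = begin
  eval (p *ₚ (p ^ₚ k)) t        ≡⟨ eval-*ₚ p (p ^ₚ k) t ⟩
  eval p t ℤ.* eval (p ^ₚ k) t  ≡⟨ cong₂ ℤ._*_ p[t]≡b (eval-^ₚ p k t p[t]≡b) ⟩
  + b ℤ.* + (b ^ k)             ≡⟨ ℤₚ.pos-* b (b ^ k) ⟨
  + (b ^ suc k)                 ∎
  where open ≡-Reasoning

eval-negₚ : ∀ p t → eval (negₚ p) t ≡ ℤ.- eval p t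
eval-negₚ []      t = refl
eval-negₚ (a ∷ p) t = trans (cong (λ e → ℤ.- a ℤ.+ t ℤ.* e) (eval-negₚ p t)) (ℤ-solve a t (eval p t))
  where
  ℤ-solve : ∀ a t e → ℤ.- a ℤ.+ t ℤ.* (ℤ.- e) ≡ ℤ.- (a ℤ.+ t ℤ.* e)
  ℤ-solve = ℤ-solve-∀

DegreeAtMost : Poly → ℕ → Set
DegreeAtMost p d = ∀ i → d < i → coeff p i ≡ + 0

record Leading (p : Poly) (d : ℕ) (a : ℤ) : Set where
  constructor leading
  field
    coeff-deg : coeff p d ≡ a
    degree≤   : DegreeAtMost p d
open Leading

Leading-resp-≈ : ∀ {p q d a} → p ≈ q → Leading p d a → Leading q d a
Leading-resp-≈ p≈q (leading pd≡a p≤d) =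
  leading (trans (sym (coeff≡ p≈q _)) pd≡a) (λ i d<i → trans (sym (coeff≡ p≈q i)) (p≤d i d<i))

Leading-+ₚ-lower : ∀ {u p e d a} → DegreeAtMost u e → e < d → Leading p d a → Leading (u +ₚ p) d a
Leading-+ₚ-lower {u} {p} {e} {d} u≤e e<d (leading pd≡a p≤d) = leading
  (trans (coeff-+ₚ u p d) (trans (cong₂ ℤ._+_ (u≤e d e<d) pd≡a) (ℤₚ.+-identityˡ _)))
  (λ i d<i → trans (coeff-+ₚ u p i) (cong₂ ℤ._+_ (u≤e i (ℕₚ.<-trans e<d d<i)) (p≤d i d<i)))

Leading-scale : ∀ a {q e b} → Leading q e b → Leading (scale a q) e (a ℤ.* b)
Leading-scale a {q} (leading qe≡b q≤e) = leading
  (trans (coeff-scale a q _) (cong (a ℤ.*_) qe≡b))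
  (λ i e<i → trans (coeff-scale a q i) (trans (cong (a ℤ.*_) (q≤e i e<i)) (ℤₚ.*-zeroʳ a)))

Leading-0∷ : ∀ {r d a} → Leading r d a → Leading (+ 0 ∷ r) (suc d) a
Leading-0∷ (leading rd≡a r≤d) = leading rd≡a λ { zero () ; (suc i) (s≤s d<i) → r≤d i d<i }

Leading-*ₚ : ∀ {p q d e a b} → Leading p d a → Leading q e b → Leading (p *ₚ q) (d + e) (a ℤ.* b)
Leading-*ₚ {[]} {q} {b = b} (leading pd≡a _) _ =
  leading (trans (sym (ℤₚ.*-zeroˡ b)) (cong (ℤ._* b) pd≡a)) (λ _ _ → refl)
Leading-*ₚ {c ∷ p} {q} {zero} {b = b} (leading c≡a p≤0) q-lead =
  Leading-resp-≈ (≈-trans (≈-sym (+ₚ-identityʳ (scale c q)))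
                          (+ₚ-cong ≈-refl (≈-sym (≈-trans (∷-cong refl (*ₚ-zeroˡ q p≈[])) 0∷[]≈[]))))
                 (subst (λ a → Leading (scale c q) _ (a ℤ.* b)) c≡a (Leading-scale c q-lead))
  where
  p≈[] : p ≈ []
  p≈[] = coeffwise λ i → p≤0 (suc i) (s≤s z≤n)
Leading-*ₚ {c ∷ p} {q} {suc d} {e} (leading pd≡a p≤d) q-lead =
  Leading-+ₚ-lower (degree≤ (Leading-scale c q-lead)) (s≤s (ℕₚ.m≤n+m e d))
    (Leading-0∷ (Leading-*ₚ {p} (leading pd≡a (λ i d<i → p≤d (suc i) (s≤s d<i))) q-lead))

Nonzero : Poly → Set
Nonzero p = Σ ℕ λ d → Σ ℤ λ a → (a ≢ + 0) × Leading p d a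

≈[]⊎Nonzero : ∀ p → p ≈ [] ⊎ Nonzero p
≈[]⊎Nonzero []      = inj₁ ≈-refl
≈[]⊎Nonzero (a ∷ p) with ≈[]⊎Nonzero p
... | inj₂ (d , b , b≢0 , leading pd≡b p≤d) =
  inj₂ (suc d , b , b≢0 , leading pd≡b λ { zero () ; (suc i) (s≤s d<i) → p≤d i d<i })
... | inj₁ p≈[] with a ℤ.≟ + 0
...   | yes a≡0 = inj₁ (≈-trans (∷-cong a≡0 p≈[]) 0∷[]≈[])
...   | no  a≢0 = inj₂ (0 , a , a≢0 , leading refl λ { zero () ; (suc i) _ → coeff≡ p≈[] i })

ℤ-*-≢0 : ∀ {a b} → a ≢ + 0 → b ≢ + 0 → a ℤ.* b ≢ + 0
ℤ-*-≢0 {a} a≢0 b≢0 ab≡0 with ℤₚ.i*j≡0⇒i≡0∨j≡0 a ab≡0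
... | inj₁ a≡0 = a≢0 a≡0
... | inj₂ b≡0 = b≢0 b≡0

*ₚ-nonzero : ∀ {p q} → Nonzero p → Nonzero q → ¬ ((p *ₚ q) ≈ [])
*ₚ-nonzero (d , a , a≢0 , p-lead) (e , b , b≢0 , q-lead) pq≈[] =
  ℤ-*-≢0 a≢0 b≢0 (trans (sym (coeff-deg (Leading-*ₚ p-lead q-lead))) (coeff≡ pq≈[] (d + e)))

*ₚ-cancelʳ : ∀ {p q r} → Nonzero r → (p *ₚ r) ≈ (q *ₚ r) → p ≈ q
*ₚ-cancelʳ {p} {q} {r} r≢0 pr≈qr with ≈[]⊎Nonzero (p +ₚ negₚ q)
... | inj₁ p-q≈0 = ≈-trans (sub-add p q) (+ₚ-cong p-q≈0 ≈-refl)
  where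
  sub-add : ∀ p q → p ≈ ((p +ₚ negₚ q) +ₚ q)
  sub-add = solve-∀ ℤ[x]-almostCommutativeRing
... | inj₂ p-q≢0 = ⊥-elim (*ₚ-nonzero p-q≢0 r≢0 (≈-trans (distrib p q r)
                            (≈-trans (+ₚ-cong pr≈qr ≈-refl) (+ₚ-inverseʳ (q *ₚ r)))))
  where
  distrib : ∀ p q r → ((p +ₚ negₚ q) *ₚ r) ≈ ((p *ₚ r) +ₚ negₚ (q *ₚ r))
  distrib = solve-∀ ℤ[x]-almostCommutativeRing

Leading-constₚ : ∀ {p d a m} → a ≢ + 0 → Leading p d a → p ≈ constₚ m → d ≡ 0
Leading-constₚ {d = zero}  _   _      _      = refl
Leading-constₚ {d = suc d} a≢0 p-lead p≈m = ⊥-elim (a≢0 (trans (sym (coeff-deg p-lead)) (coeff≡ p≈m (suc d))))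

∣constₚ⇒constₚ : ∀ {R m} → m ≢ + 0 → R ∣ constₚ m → Σ ℤ λ r → (r ≢ + 0) × (R ≈ constₚ r)
∣constₚ⇒constₚ {R} {m} m≢0 (U , UR≈m) with ≈[]⊎Nonzero U | ≈[]⊎Nonzero R
... | inj₁ U≈[] | _ = ⊥-elim (m≢0 (trans (sym (coeff≡ UR≈m 0)) (coeff≡ (*ₚ-zeroˡ R U≈[]) 0)))
... | inj₂ _ | inj₁ R≈[] =
  ⊥-elim (m≢0 (trans (sym (coeff≡ UR≈m 0)) (coeff≡ (≈-trans (*ₚ-congʳ U R≈[]) (*ₚ-zeroʳ U)) 0)))
... | inj₂ (d , u , u≢0 , U-lead) | inj₂ (e , r , r≢0 , R-lead) =
  r , r≢0 , coeffwise λ { zero → trans (cong (coeff R) (sym e≡0)) (coeff-deg R-lead)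
                        ; (suc i) → degree≤ R-lead (suc i) (subst (_< suc i) (sym e≡0) (s≤s z≤n)) }
  where
  e≡0 : e ≡ 0
  e≡0 = ℕₚ.m+n≡0⇒n≡0 d (Leading-constₚ (ℤ-*-≢0 u≢0 r≢0) (Leading-*ₚ U-lead R-lead) UR≈m)

∣oneₚ⇒unit : ∀ {R} → R ∣ oneₚ → Σ ℤ λ r → (R ≈ constₚ r) × (ℤ.∣ r ∣ ≡ 1)
∣oneₚ⇒unit {R} (U , UR≈1) with ∣constₚ⇒constₚ (λ ()) (U , UR≈1)
... | r , _ , R≈r = r , R≈r , ℕₚ.m*n≡1⇒m≡1 ℤ.∣ r ∣ ℤ.∣ coeff U 0 ∣ ∣r*u₀∣≡1
  where
  r*u₀≡1 : r ℤ.* coeff U 0 ≡ + 1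
  r*u₀≡1 = begin
    r ℤ.* coeff U 0          ≡⟨ coeff-scale r U 0 ⟨
    coeff (scale r U) 0      ≡⟨ coeff≡ (*ₚ-constʳ U r) 0 ⟨
    coeff (U *ₚ constₚ r) 0  ≡⟨ coeff≡ (*ₚ-congʳ U R≈r) 0 ⟨
    coeff (U *ₚ R) 0         ≡⟨ coeff≡ UR≈1 0 ⟩
    + 1                      ∎
    where open ≡-Reasoning
  ∣r*u₀∣≡1 : ℤ.∣ r ∣ * ℤ.∣ coeff U 0 ∣ ≡ 1
  ∣r*u₀∣≡1 = trans (sym (ℤₚ.abs-* r (coeff U 0))) (cong ℤ.∣_∣ r*u₀≡1)

constₚ-∣⇒∣oneₚ : ∀ {R r p} → R ≈ constₚ r → R ∣ p → eval p (+ 0) ≡ + 1 → R ∣ oneₚ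
constₚ-∣⇒∣oneₚ {R} {r} {p} R≈r (T , TR≈p) p[0]≡1 = constₚ t , (begin
  constₚ t *ₚ R         ≈⟨ *ₚ-congʳ (constₚ t) R≈r ⟩
  constₚ t *ₚ constₚ r  ≈⟨ constₚ-*ₚ t r ⟩
  constₚ (t ℤ.* r)      ≈⟨ ≈-reflexive (cong constₚ t*r≡1) ⟩
  oneₚ                  ∎)
  where
  t : ℤ
  t = eval T (+ 0)
  t*r≡1 : t ℤ.* r ≡ + 1
  t*r≡1 = begin
    t ℤ.* r              ≡⟨ cong (t ℤ.*_) (trans (eval-cong (+ 0) R≈r) (eval-constₚ r (+ 0))) ⟨
    t ℤ.* eval R (+ 0)   ≡⟨ eval-*ₚ T R (+ 0) ⟨
    eval (T *ₚ R) (+ 0)  ≡⟨ eval-cong (+ 0) TR≈p ⟩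
    eval p (+ 0)         ≡⟨ p[0]≡1 ⟩
    + 1                  ∎
    where open ≡-Reasoning
  open ≈-Reasoning

PosLeading-Leading : ∀ {p d a} → PosLeading p → a ≢ + 0 → Leading p d a → + 0 ℤ.< a
PosLeading-Leading {p} {d} (d′ , 0<p[d′] , p≤d′) a≢0 (leading pd≡a p≤d) with ℕₚ.<-cmp d d′
... | tri< d<d′ _ _ = ⊥-elim (ℤₚ.<-irrefl refl (subst (+ 0 ℤ.<_) (p≤d d′ d<d′) 0<p[d′]))
... | tri≈ _ refl _ = subst (+ 0 ℤ.<_) pd≡a 0<p[d′]
... | tri> _ _ d′<d = ⊥-elim (a≢0 (trans (sym pd≡a) (p≤d′ d d′<d)))

Monic : Poly → Set
Monic p = Σ ℕ λ d → Leading p d (+ 1)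

Monic⇒Nonzero : ∀ {p} → Monic p → Nonzero p
Monic⇒Nonzero (d , p-lead) = d , + 1 , (λ ()) , p-lead

Monic-oneₚ : Monic oneₚ
Monic-oneₚ = 0 , leading refl λ { zero () ; (suc i) _ → refl }

Monic-*ₚ : ∀ {p q} → Monic p → Monic q → Monic (p *ₚ q)
Monic-*ₚ (d , p-lead) (e , q-lead) = d + e , Leading-*ₚ p-lead q-lead

Monic-^ₚ : ∀ {p} k → Monic p → Monic (p ^ₚ k)
Monic-^ₚ zero    _       = Monic-oneₚ
Monic-^ₚ (suc k) p-monic = Monic-*ₚ p-monic (Monic-^ₚ k p-monic)

Leading-monomial : ∀ m → Leading (monomial m) m (+ 1)
Leading-monomial zero    = leading refl λ { zero () ; (suc i) _ → refl }
Leading-monomial (suc m) = Leading-0∷ (Leading-monomial m)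

Monic-1+monomial : ∀ {m} → 0 < m → Monic (oneₚ +ₚ monomial m)
Monic-1+monomial {m} 0<m =
  m , Leading-+ₚ-lower (λ { zero () ; (suc i) _ → refl }) 0<m (Leading-monomial m)

monic-associate : ∀ {R G₀ G} → Monic G₀ → R ∣ oneₚ → (R *ₚ G₀) ≈ G → PosLeading G → G ≈ G₀
monic-associate {R} {G₀} {G} (d , G₀-lead) R∣1 RG₀≈G G-posLeading with ∣oneₚ⇒unit R∣1
... | r , R≈r , ∣r∣≡1 = ≈-trans G≈rG₀ (≈-trans (≈-reflexive (cong (λ c → scale c G₀) r≡1)) (scale-one G₀))
  where
  G≈rG₀ : G ≈ scale r G₀
  G≈rG₀ = ≈-trans (≈-sym RG₀≈G) (≈-trans (*ₚ-congˡ G₀ R≈r) (*ₚ-constˡ r G₀))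
  G-lead : Leading G d r
  G-lead = subst (Leading G d) (ℤₚ.*-identityʳ r) (Leading-resp-≈ (≈-sym G≈rG₀) (Leading-scale r G₀-lead))
  r≢0 : r ≢ + 0
  r≢0 r≡0 = 0≢1 (trans (sym (cong ℤ.∣_∣ r≡0)) ∣r∣≡1)
    where
    0≢1 : 0 ≢ 1
    0≢1 ()
  r≡1 : r ≡ + 1
  r≡1 = trans (sym (ℤₚ.0≤i⇒+∣i∣≡i (ℤₚ.<⇒≤ (PosLeading-Leading G-posLeading r≢0 G-lead)))) (cong +_ ∣r∣≡1)

∏ₚ : ℕ → (ℕ → Poly) → Poly
∏ₚ zero    f = oneₚ
∏ₚ (suc M) f = f 0 *ₚ ∏ₚ M (λ k → f (suc k))

syntax ∏ₚ M (λ k → e) = ∏[ k < M ] e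

∏-cong : ∀ {f g} M → (∀ k → k < M → f k ≈ g k) → ∏ₚ M f ≈ ∏ₚ M g
∏-cong zero    f≈g = ≈-refl
∏-cong (suc M) f≈g = *ₚ-cong (f≈g 0 (s≤s z≤n)) (∏-cong M λ k k<M → f≈g (suc k) (s≤s k<M))

∏-*ₚ : ∀ f g M → (∏[ k < M ] (f k *ₚ g k)) ≈ (∏ₚ M f *ₚ ∏ₚ M g)
∏-*ₚ f g zero    = ≈-sym (*ₚ-identityˡ oneₚ)
∏-*ₚ f g (suc M) = ≈-trans (*ₚ-congʳ (f 0 *ₚ g 0) (∏-*ₚ (λ k → f (suc k)) (λ k → g (suc k)) M))
                           (*ₚ-interchange (f 0) (g 0) _ _)

∏-^ₚ : ∀ p d M → (∏[ k < M ] (p ^ₚ d k)) ≈ (p ^ₚ ∑ M d)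
∏-^ₚ p d zero    = ≈-refl
∏-^ₚ p d (suc M) = ≈-trans (*ₚ-congʳ (p ^ₚ d 0) (∏-^ₚ p (λ k → d (suc k)) M)) (≈-sym (^ₚ-+ p (d 0) _))

∏-snoc : ∀ f M → ∏ₚ (suc M) f ≈ (∏ₚ M f *ₚ f M)
∏-snoc f zero    = *ₚ-comm (f 0) oneₚ
∏-snoc f (suc M) = ≈-trans (*ₚ-congʳ (f 0) (∏-snoc (λ k → f (suc k)) M)) (≈-sym (*ₚ-assoc (f 0) _ _))

∏-Monic : ∀ f M → (∀ k → Monic (f k)) → Monic (∏ₚ M f)
∏-Monic f zero    _       = Monic-oneₚ
∏-Monic f (suc M) f-monic = Monic-*ₚ (f-monic 0) (∏-Monic (λ k → f (suc k)) M λ k → f-monic (suc k))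

∣-∏ : ∀ f M {i} → i < M → f i ∣ ∏ₚ M f
∣-∏ f (suc M) {zero}  _         = ∏ₚ M (λ k → f (suc k)) , *ₚ-comm _ (f 0)
∣-∏ f (suc M) {suc i} (s≤s i<M) with ∣-∏ (λ k → f (suc k)) M i<M
... | w , w*fi≈∏ = f 0 *ₚ w , ≈-trans (*ₚ-assoc (f 0) w (f (suc i))) (*ₚ-congʳ (f 0) w*fi≈∏)

∏-prefix-^ₚ : ∀ f d M →
  (∏[ k < M ] (∏ₚ (suc k) f ^ₚ d k)) ≈ (∏[ j < M ] (f j ^ₚ (∑[ j ≤ k < M ] d k)))
∏-prefix-^ₚ f d zero    = ≈-refl
∏-prefix-^ₚ f d (suc M) = begin
  (∏ₚ 1 f ^ₚ d 0) *ₚ (∏[ k < M ] ((f 0 *ₚ ∏ₚ (suc k) f⁺) ^ₚ d⁺ k))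
    ≈⟨ *ₚ-cong (^ₚ-cong (d 0) (*ₚ-identityʳ (f 0))) tail ⟩
  (f 0 ^ₚ d 0) *ₚ ((f 0 ^ₚ ∑ M d⁺) *ₚ rest)
    ≈⟨ ≈-sym (*ₚ-assoc (f 0 ^ₚ d 0) (f 0 ^ₚ ∑ M d⁺) rest) ⟩
  ((f 0 ^ₚ d 0) *ₚ (f 0 ^ₚ ∑ M d⁺)) *ₚ rest
    ≈⟨ *ₚ-congˡ rest (≈-sym (^ₚ-+ (f 0) (d 0) (∑ M d⁺))) ⟩
  (f 0 ^ₚ ∑ (suc M) d) *ₚ rest
    ∎
  where
  open ≈-Reasoning
  f⁺ : ℕ → Poly
  f⁺ j = f (suc j)
  d⁺ : ℕ → ℕ
  d⁺ k = d (suc k)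
  rest : Poly
  rest = ∏[ j < M ] (f⁺ j ^ₚ (∑[ j ≤ k < M ] d⁺ k))
  tail : (∏[ k < M ] ((f 0 *ₚ ∏ₚ (suc k) f⁺) ^ₚ d⁺ k)) ≈ ((f 0 ^ₚ ∑ M d⁺) *ₚ rest)
  tail = begin
    ∏[ k < M ] ((f 0 *ₚ ∏ₚ (suc k) f⁺) ^ₚ d⁺ k)
      ≈⟨ ∏-cong M (λ k _ → ^ₚ-distrib-*ₚ (f 0) (∏ₚ (suc k) f⁺) (d⁺ k)) ⟩
    ∏[ k < M ] ((f 0 ^ₚ d⁺ k) *ₚ (∏ₚ (suc k) f⁺ ^ₚ d⁺ k))
      ≈⟨ ∏-*ₚ (λ k → f 0 ^ₚ d⁺ k) (λ k → ∏ₚ (suc k) f⁺ ^ₚ d⁺ k) M ⟩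
    (∏[ k < M ] (f 0 ^ₚ d⁺ k)) *ₚ (∏[ k < M ] (∏ₚ (suc k) f⁺ ^ₚ d⁺ k))
      ≈⟨ *ₚ-cong (∏-^ₚ (f 0) d⁺ M) (∏-prefix-^ₚ f⁺ d⁺ M) ⟩
    (f 0 ^ₚ ∑ M d⁺) *ₚ rest
      ∎

prodₚ-map-applyUpTo : ∀ (g : ℕ → Poly) (h : ℕ → ℕ) M → prodₚ (map g (applyUpTo h M)) ≡ ∏[ k < M ] g (h k)
prodₚ-map-applyUpTo g h zero    = refl
prodₚ-map-applyUpTo g h (suc M) = cong (g (h 0) *ₚ_) (prodₚ-map-applyUpTo g (λ k → h (suc k)) M)

eval-∏-^ : ∀ f M t b (e : ℕ → ℕ) → (∀ j → j < M → eval (f j) t ≡ + (b ^ e j)) →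
           eval (∏ₚ M f) t ≡ + (b ^ ∑ M e)
eval-∏-^ f zero    t b e _        = eval-constₚ (+ 1) t
eval-∏-^ f (suc M) t b e f[t]≡bᵉ = begin
  eval (f 0 *ₚ ∏ₚ M (λ k → f (suc k))) t            ≡⟨ eval-*ₚ (f 0) _ t ⟩
  eval (f 0) t ℤ.* eval (∏ₚ M (λ k → f (suc k))) t  ≡⟨ cong₂ ℤ._*_ (f[t]≡bᵉ 0 (s≤s z≤n))
                                                             (eval-∏-^ (λ k → f (suc k)) M t b (λ k → e (suc k))
                                                                λ j j<M → f[t]≡bᵉ (suc j) (s≤s j<M)) ⟩
  + (b ^ e 0) ℤ.* + (b ^ ∑ M (λ k → e (suc k)))  ≡⟨ ℤₚ.pos-* (b ^ e 0) _ ⟨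
  + (b ^ e 0 * b ^ ∑ M (λ k → e (suc k)))        ≡⟨ cong +_ (ℕₚ.^-distribˡ-+-* b (e 0) _) ⟨
  + (b ^ ∑ (suc M) e)                            ∎
  where open ≡-Reasoning

prefix-product-factorisation : ∀ f (a μ : ℕ → ℕ) M →
  (∀ i → i < M → ∑[ i ≤ k < M ] μ k ≤ a i) → a M ≡ 0 →
  (∏[ k < M ] (∏ₚ (suc k) f ^ₚ (a k ∸ μ k))) ≈
  ((∏[ j < M ] (f j ^ₚ (a j ∸ ∑[ j ≤ k < M ] μ k))) *ₚ (∏[ k < M ] (∏ₚ (suc k) f ^ₚ a (suc k))))
prefix-product-factorisation f a μ M ν≤a aM≡0 = begin
  ∏[ k < M ] (∏ₚ (suc k) f ^ₚ (a k ∸ μ k))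
    ≈⟨ ∏-prefix-^ₚ f (λ k → a k ∸ μ k) M ⟩
  ∏[ j < M ] (f j ^ₚ (∑[ j ≤ k < M ] (a k ∸ μ k)))
    ≈⟨ ∏-cong M (λ j j<M → ^ₚ-congʳ (f j) (∑-range-∸-split a μ M ν≤a aM≡0 j j<M)) ⟩
  ∏[ j < M ] (f j ^ₚ (c j + ∑[ j ≤ k < M ] a (suc k)))
    ≈⟨ ∏-cong M (λ j _ → ^ₚ-+ (f j) (c j) _) ⟩
  ∏[ j < M ] ((f j ^ₚ c j) *ₚ (f j ^ₚ (∑[ j ≤ k < M ] a (suc k))))
    ≈⟨ ∏-*ₚ (λ j → f j ^ₚ c j) (λ j → f j ^ₚ (∑[ j ≤ k < M ] a (suc k))) M ⟩
  (∏[ j < M ] (f j ^ₚ c j)) *ₚ (∏[ j < M ] (f j ^ₚ (∑[ j ≤ k < M ] a (suc k))))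
    ≈⟨ *ₚ-congʳ (∏[ j < M ] (f j ^ₚ c j)) (≈-sym (∏-prefix-^ₚ f (λ k → a (suc k)) M)) ⟩
  (∏[ j < M ] (f j ^ₚ c j)) *ₚ (∏[ k < M ] (∏ₚ (suc k) f ^ₚ a (suc k)))
    ∎
  where
  open ≈-Reasoning
  c : ℕ → ℕ
  c j = a j ∸ ∑[ j ≤ k < M ] μ k

-- The factors of 1 + x^(3^k)

y : ℕ → Poly
y k = monomial (3 ^ k)

P : ℕ → Poly
P k = oneₚ +ₚ y k

-- Q k is the cyclotomic polynomial Φ_(2·3^k).
Q : ℕ → Poly
Q zero    = P 0
Q (suc k) = oneₚ +ₚ (y k *ₚ (y k +ₚ negₚ oneₚ))

y-suc : ∀ k → y (suc k) ≈ (y k *ₚ (y k *ₚ y k))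
y-suc k = begin
  monomial (m + (m + (m + 0)))      ≈⟨ monomial-+ m _ ⟩
  y k *ₚ monomial (m + (m + 0))     ≈⟨ *ₚ-congʳ (y k) (monomial-+ m _) ⟩
  y k *ₚ (y k *ₚ monomial (m + 0))  ≈⟨ *ₚ-congʳ (y k) (*ₚ-congʳ (y k) (≈-reflexive (cong monomial (ℕₚ.+-identityʳ m)))) ⟩
  y k *ₚ (y k *ₚ y k)               ∎
  where
  open ≈-Reasoning
  m : ℕ
  m = 3 ^ k

P-suc : ∀ k → P (suc k) ≈ (P k *ₚ Q (suc k))
P-suc k = ≈-trans (+ₚ-cong (≈-refl {oneₚ}) (y-suc k)) (≈-sym (sum-of-cubes (y k)))
  where
  sum-of-cubes : ∀ y → ((oneₚ +ₚ y) *ₚ (oneₚ +ₚ (y *ₚ (y +ₚ negₚ oneₚ)))) ≈ (oneₚ +ₚ (y *ₚ (y *ₚ y)))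
  sum-of-cubes = solve-∀ ℤ[x]-almostCommutativeRing

P≈∏Q : ∀ k → P k ≈ ∏ₚ (suc k) Q
P≈∏Q zero    = ≈-sym (≈-trans (*ₚ-comm (Q 0) oneₚ) (*ₚ-identityˡ (Q 0)))
P≈∏Q (suc k) = ≈-trans (P-suc k) (≈-trans (*ₚ-congˡ (Q (suc k)) (P≈∏Q k)) (≈-sym (∏-snoc Q (suc k))))

t³≡t⇒eval-y≡t : ∀ k t → (t ℤ.* (t ℤ.* t) ≡ t) → eval (y k) t ≡ t
t³≡t⇒eval-y≡t zero    t _        = trans (cong (λ e → + 0 ℤ.+ t ℤ.* e) (eval-constₚ (+ 1) t))
                                  (trans (ℤₚ.+-identityˡ _) (ℤₚ.*-identityʳ t))
t³≡t⇒eval-y≡t (suc k) t t³≡t = begin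
  eval (y (suc k)) t                                ≡⟨ eval-cong t (y-suc k) ⟩
  eval (y k *ₚ (y k *ₚ y k)) t                      ≡⟨ eval-*ₚ (y k) (y k *ₚ y k) t ⟩
  eval (y k) t ℤ.* eval (y k *ₚ y k) t              ≡⟨ cong (eval (y k) t ℤ.*_) (eval-*ₚ (y k) (y k) t) ⟩
  eval (y k) t ℤ.* (eval (y k) t ℤ.* eval (y k) t)  ≡⟨ cong (λ e → e ℤ.* (e ℤ.* e)) (t³≡t⇒eval-y≡t k t t³≡t) ⟩
  t ℤ.* (t ℤ.* t)                                   ≡⟨ t³≡t ⟩
  t                                                 ∎
  where open ≡-Reasoning

eval-P : ∀ k t → eval (P k) t ≡ + 1 ℤ.+ eval (y k) t
eval-P k t = trans (eval-+ₚ oneₚ (y k) t) (cong (ℤ._+ eval (y k) t) (eval-constₚ (+ 1) t))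

eval-Q-suc : ∀ k t → eval (Q (suc k)) t ≡ + 1 ℤ.+ eval (y k) t ℤ.* (eval (y k) t ℤ.+ ℤ.- + 1)
eval-Q-suc k t = begin
  eval (oneₚ +ₚ (y k *ₚ (y k +ₚ negₚ oneₚ))) t
    ≡⟨ eval-+ₚ oneₚ (y k *ₚ (y k +ₚ negₚ oneₚ)) t ⟩
  eval oneₚ t ℤ.+ eval (y k *ₚ (y k +ₚ negₚ oneₚ)) t
    ≡⟨ cong₂ ℤ._+_ (eval-constₚ (+ 1) t) (eval-*ₚ (y k) (y k +ₚ negₚ oneₚ) t) ⟩
  + 1 ℤ.+ eval (y k) t ℤ.* eval (y k +ₚ negₚ oneₚ) t
    ≡⟨ cong (λ e → + 1 ℤ.+ eval (y k) t ℤ.* e)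
            (trans (eval-+ₚ (y k) (negₚ oneₚ) t) (cong (λ e → eval (y k) t ℤ.+ e)
                   (trans (eval-negₚ oneₚ t) (cong ℤ.-_ (eval-constₚ (+ 1) t))))) ⟩
  + 1 ℤ.+ eval (y k) t ℤ.* (eval (y k) t ℤ.+ ℤ.- + 1)
    ∎
  where open ≡-Reasoning

eval-Q-0 : ∀ j → eval (Q j) (+ 0) ≡ + 1
eval-Q-0 zero    = trans (eval-P 0 (+ 0)) (cong (λ e → + 1 ℤ.+ e) (t³≡t⇒eval-y≡t 0 (+ 0) refl))
eval-Q-0 (suc k) =
  trans (eval-Q-suc k (+ 0)) (cong (λ e → + 1 ℤ.+ e ℤ.* (e ℤ.+ ℤ.- + 1)) (t³≡t⇒eval-y≡t k (+ 0) refl))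

eval-Q₀-[-1] : eval (Q 0) -1ℤ ≡ + 0
eval-Q₀-[-1] = trans (eval-P 0 -1ℤ) (cong (λ e → + 1 ℤ.+ e) (t³≡t⇒eval-y≡t 0 -1ℤ refl))

eval-Q-suc-[-1] : ∀ k → eval (Q (suc k)) -1ℤ ≡ + 3
eval-Q-suc-[-1] k =
  trans (eval-Q-suc k -1ℤ) (cong (λ e → + 1 ℤ.+ e ℤ.* (e ℤ.+ ℤ.- + 1)) (t³≡t⇒eval-y≡t k -1ℤ refl))

-- Coprimality up to powers of 3

3^ₚ : ℕ → Poly
3^ₚ s = constₚ (+ (3 ^ s))

3^≢0 : ∀ s → + (3 ^ s) ≢ + 0
3^≢0 s 3ˢ≡0 = ℕ.≢-nonZero⁻¹ (3 ^ s) {{ℕₚ.m^n≢0 3 s}} (ℤₚ.+-injective 3ˢ≡0)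

3^ₚ-+ : ∀ s t → (3^ₚ s *ₚ 3^ₚ t) ≈ 3^ₚ (s + t)
3^ₚ-+ s t = ≈-trans (constₚ-*ₚ (+ (3 ^ s)) (+ (3 ^ t)))
  (≈-reflexive (cong constₚ (trans (sym (ℤₚ.pos-* (3 ^ s) _)) (cong +_ (sym (ℕₚ.^-distribˡ-+-* 3 s t))))))

-- X and Y generate an ideal of ℤ[x] containing a power of 3, i.e. they are coprime in ℤ[1/3][x].
Coprime₃ : Poly → Poly → Set
Coprime₃ X Y = Σ ℕ λ s → Σ Poly λ u → Σ Poly λ v → ((u *ₚ X) +ₚ (v *ₚ Y)) ≈ 3^ₚ s

Coprime₃-sym : ∀ {X Y} → Coprime₃ X Y → Coprime₃ Y X
Coprime₃-sym {X} {Y} (s , u , v , uX+vY≈3ˢ) = s , v , u , ≈-trans (+ₚ-comm (v *ₚ Y) (u *ₚ X)) uX+vY≈3ˢ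

Coprime₃-oneₚ : ∀ Y → Coprime₃ oneₚ Y
Coprime₃-oneₚ Y = 0 , oneₚ , [] , ≈-trans (+ₚ-identityʳ _) (*ₚ-identityˡ oneₚ)

Coprime₃-respˡ-≈ : ∀ {X X′ Y} → X ≈ X′ → Coprime₃ X Y → Coprime₃ X′ Y
Coprime₃-respˡ-≈ X≈X′ (s , u , v , uX+vY≈3ˢ) =
  s , u , v , ≈-trans (+ₚ-cong (*ₚ-congʳ u (≈-sym X≈X′)) ≈-refl) uX+vY≈3ˢ

Coprime₃-*ₚ : ∀ {X₁ X₂ Y} → Coprime₃ X₁ Y → Coprime₃ X₂ Y → Coprime₃ (X₁ *ₚ X₂) Y
Coprime₃-*ₚ {X₁} {X₂} {Y} (s₁ , u₁ , v₁ , e₁) (s₂ , u₂ , v₂ , e₂) =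
  s₁ + s₂ , u₁ *ₚ u₂ , v ,
  ≈-trans (≈-sym (expand u₁ X₁ v₁ Y u₂ X₂ v₂)) (≈-trans (*ₚ-cong e₁ e₂) (3^ₚ-+ s₁ s₂))
  where
  v : Poly
  v = ((v₁ *ₚ u₂) *ₚ X₂) +ₚ (((u₁ *ₚ X₁) *ₚ v₂) +ₚ ((v₁ *ₚ v₂) *ₚ Y))
  expand : ∀ u₁ X₁ v₁ Y u₂ X₂ v₂ →
    (((u₁ *ₚ X₁) +ₚ (v₁ *ₚ Y)) *ₚ ((u₂ *ₚ X₂) +ₚ (v₂ *ₚ Y))) ≈
    (((u₁ *ₚ u₂) *ₚ (X₁ *ₚ X₂)) +ₚ
     ((((v₁ *ₚ u₂) *ₚ X₂) +ₚ (((u₁ *ₚ X₁) *ₚ v₂) +ₚ ((v₁ *ₚ v₂) *ₚ Y))) *ₚ Y))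
  expand = solve-∀ ℤ[x]-almostCommutativeRing

Coprime₃-^ₚ : ∀ {X Y} k → Coprime₃ X Y → Coprime₃ (X ^ₚ k) Y
Coprime₃-^ₚ zero    _        = Coprime₃-oneₚ _
Coprime₃-^ₚ (suc k) X⊥Y      = Coprime₃-*ₚ X⊥Y (Coprime₃-^ₚ k X⊥Y)

Coprime₃-∏ : ∀ g M {Y} → (∀ i → i < M → Coprime₃ (g i) Y) → Coprime₃ (∏ₚ M g) Y
Coprime₃-∏ g zero    _   = Coprime₃-oneₚ _
Coprime₃-∏ g (suc M) g⊥Y =
  Coprime₃-*ₚ (g⊥Y 0 (s≤s z≤n)) (Coprime₃-∏ (λ k → g (suc k)) M λ i i<M → g⊥Y (suc i) (s≤s i<M))

-- For i < j, Q i divides P (j - 1), and Q j = 3 + P (j - 1) · (y (j - 1) - 2).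
Q-Coprime₃-< : ∀ {i j} → i < j → Coprime₃ (Q j) (Q i)
Q-Coprime₃-< {i} {suc k} (s≤s i≤k) with ∣-∏ Q (suc k) (s≤s i≤k)
... | w , wQᵢ≈∏ = 1 , oneₚ , negₚ (w *ₚ z) , bezout
  where
  three : Poly
  three = constₚ (+ 3)
  z : Poly
  z = y k +ₚ negₚ (constₚ (+ 2))
  P≈wQᵢ : P k ≈ (w *ₚ Q i)
  P≈wQᵢ = ≈-trans (P≈∏Q k) (≈-sym wQᵢ≈∏)
  Q-suc≈ : ∀ y → (oneₚ +ₚ (y *ₚ (y +ₚ negₚ oneₚ))) ≈ (three +ₚ ((oneₚ +ₚ y) *ₚ (y +ₚ negₚ (constₚ (+ 2)))))
  Q-suc≈ = solve-∀ ℤ[x]-almostCommutativeRing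
  cancel : ∀ c q w z → ((oneₚ *ₚ (c +ₚ ((w *ₚ q) *ₚ z))) +ₚ (negₚ (w *ₚ z) *ₚ q)) ≈ c
  cancel = solve-∀ ℤ[x]-almostCommutativeRing
  bezout : ((oneₚ *ₚ Q (suc k)) +ₚ (negₚ (w *ₚ z) *ₚ Q i)) ≈ three
  bezout = begin
    (oneₚ *ₚ Q (suc k)) +ₚ (negₚ (w *ₚ z) *ₚ Q i)
      ≈⟨ +ₚ-cong (*ₚ-congʳ oneₚ (Q-suc≈ (y k))) ≈-refl ⟩
    (oneₚ *ₚ (three +ₚ (P k *ₚ z))) +ₚ (negₚ (w *ₚ z) *ₚ Q i)
      ≈⟨ +ₚ-cong (*ₚ-congʳ oneₚ (+ₚ-cong (≈-refl {three}) (*ₚ-congˡ z P≈wQᵢ))) ≈-refl ⟩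
    (oneₚ *ₚ (three +ₚ ((w *ₚ Q i) *ₚ z))) +ₚ (negₚ (w *ₚ z) *ₚ Q i)
      ≈⟨ cancel three (Q i) w z ⟩
    three
      ∎
    where open ≈-Reasoning

Q-Coprime₃ : ∀ {i j} → i ≢ j → Coprime₃ (Q i) (Q j)
Q-Coprime₃ {i} {j} i≢j with ℕₚ.<-cmp i j
... | tri< i<j _ _ = Coprime₃-sym (Q-Coprime₃-< i<j)
... | tri≈ _ i≡j _ = ⊥-elim (i≢j i≡j)
... | tri> _ _ j<i = Q-Coprime₃-< j<i

∣-linear : ∀ {R a b} u w → R ∣ a → R ∣ b → R ∣ ((u *ₚ a) +ₚ (w *ₚ b))
∣-linear {R} u w (q₁ , q₁R≈a) (q₂ , q₂R≈b) =
  (u *ₚ q₁) +ₚ (w *ₚ q₂) ,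
  ≈-trans (expand u q₁ w q₂ R) (+ₚ-cong (*ₚ-congʳ u q₁R≈a) (*ₚ-congʳ w q₂R≈b))
  where
  expand : ∀ u q₁ w q₂ R → (((u *ₚ q₁) +ₚ (w *ₚ q₂)) *ₚ R) ≈ ((u *ₚ (q₁ *ₚ R)) +ₚ (w *ₚ (q₂ *ₚ R)))
  expand = solve-∀ ℤ[x]-almostCommutativeRing

∣-cancel-Coprime₃ : ∀ {R B g Y} → R ∣ B → Coprime₃ g B → R ∣ (Y *ₚ g) →
                    Σ ℕ λ t → R ∣ (3^ₚ t *ₚ Y)
∣-cancel-Coprime₃ {R} {B} {g} {Y} R∣B (t , u , v , ug+vB≈3ᵗ) R∣Yg =
  t , ∣ʳ-respʳ-≈ (≈-trans (regroup u g v B Y) (*ₚ-congˡ Y ug+vB≈3ᵗ)) (∣-linear u (v *ₚ Y) R∣Yg R∣B)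
  where
  regroup : ∀ u g v B Y → ((u *ₚ (Y *ₚ g)) +ₚ ((v *ₚ Y) *ₚ B)) ≈ (((u *ₚ g) +ₚ (v *ₚ B)) *ₚ Y)
  regroup = solve-∀ ℤ[x]-almostCommutativeRing

∣-∏-cancel-Coprime₃ : ∀ {R} g M Y → (∀ j → j < M → Σ Poly λ B → R ∣ B × Coprime₃ (g j) B) →
                      R ∣ (Y *ₚ ∏ₚ M g) → Σ ℕ λ s → R ∣ (3^ₚ s *ₚ Y)
∣-∏-cancel-Coprime₃ g zero    Y _ R∣Y =
  0 , ∣ʳ-respʳ-≈ (*ₚ-comm Y oneₚ) R∣Y
∣-∏-cancel-Coprime₃ {R} g (suc M) Y cancellable R∣Y∏ =
  let B , R∣B , g₀⊥B = cancellable 0 (s≤s z≤n)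
      t , R∣3ᵗYrest  = ∣-cancel-Coprime₃ {Y = Y *ₚ rest} R∣B g₀⊥B (∣ʳ-respʳ-≈ (regroup Y (g 0) rest) R∣Y∏)
      s , R∣3ˢ3ᵗY    = ∣-∏-cancel-Coprime₃ (λ k → g (suc k)) M (3^ₚ t *ₚ Y)
                         (λ j j<M → cancellable (suc j) (s≤s j<M))
                         (∣ʳ-respʳ-≈ (≈-sym (*ₚ-assoc (3^ₚ t) Y rest)) R∣3ᵗYrest)
  in s + t , ∣ʳ-respʳ-≈ (≈-trans (≈-sym (*ₚ-assoc (3^ₚ s) (3^ₚ t) Y)) (*ₚ-congˡ Y (3^ₚ-+ s t))) R∣3ˢ3ᵗY
  where
  rest : Poly
  rest = ∏ₚ M (λ k → g (suc k))
  regroup : ∀ Y g₀ rest → (Y *ₚ (g₀ *ₚ rest)) ≈ ((Y *ₚ rest) *ₚ g₀)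
  regroup = solve-∀ ℤ[x]-almostCommutativeRing

gcd-of-coprime-multiples : ∀ {A : Set} (L : List A) (h q : A → Poly) {G₀ G} → Monic G₀ →
  (∀ {x} → x ∈ L → h x ≈ (q x *ₚ G₀)) →
  (∀ R → (∀ {x} → x ∈ L → R ∣ q x) → R ∣ oneₚ) →
  IsGcdₚ (map h L) G → G ≈ G₀
gcd-of-coprime-multiples L h q {G₀} {G} G₀-monic h≈qG₀ q-coprime (G∣h , G-greatest , G-posLeading) =
  monic-associate G₀-monic (q-coprime R R∣q) RG₀≈G G-posLeading
  where
  G₀∣h : ∀ {p} → p ∈ map h L → G₀ ∣ₚ p
  G₀∣h p∈ with ∈-map⁻ h p∈
  ... | x , x∈L , refl = q x , coeff≡ (≈-sym (h≈qG₀ x∈L))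
  R : Poly
  R = proj₁ (G-greatest G₀ G₀∣h)
  RG₀≈G : (R *ₚ G₀) ≈ G
  RG₀≈G = coeffwise (proj₂ (G-greatest G₀ G₀∣h))
  R∣q : ∀ {x} → x ∈ L → R ∣ q x
  R∣q {x} x∈L with G∣h (∈-map⁺ h x∈L)
  ... | T , TG≈h = T , *ₚ-cancelʳ (Monic⇒Nonzero G₀-monic) (begin
    (T *ₚ R) *ₚ G₀  ≈⟨ *ₚ-assoc T R G₀ ⟩
    T *ₚ (R *ₚ G₀)  ≈⟨ *ₚ-congʳ T RG₀≈G ⟩
    T *ₚ G          ≈⟨ coeffwise TG≈h ⟩
    h x             ≈⟨ h≈qG₀ x∈L ⟩
    q x *ₚ G₀       ∎)
    where open ≈-Reasoning

sumₚ-map-*ₚ : ∀ {A : Set} (f : A → Poly) G L → sumₚ (map (λ x → f x *ₚ G) L) ≈ (sumₚ (map f L) *ₚ G)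
sumₚ-map-*ₚ f G []      = ≈-refl
sumₚ-map-*ₚ f G (x ∷ L) = ≈-trans (+ₚ-cong ≈-refl (sumₚ-map-*ₚ f G L)) (≈-sym (*ₚ-distribʳ G (f x) _))

sumₚ-map-cong : ∀ {A : Set} {f g : A → Poly} L → (∀ {x} → x ∈ L → f x ≈ g x) →
                sumₚ (map f L) ≈ sumₚ (map g L)
sumₚ-map-cong []      _   = ≈-refl
sumₚ-map-cong (x ∷ L) f≈g = +ₚ-cong (f≈g (here refl)) (sumₚ-map-cong L λ x∈L → f≈g (there x∈L))

eval-sumₚ-map : ∀ {A : Set} (f : A → Poly) L {x} t → Unique L → x ∈ L →
  (∀ {z} → z ∈ L → z ≢ x → eval (f z) t ≡ + 0) → eval (sumₚ (map f L)) t ≡ eval (f x) t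
eval-sumₚ-map f (z ∷ L) t (z∉L ∷ L!) (here refl) others =
  trans (eval-+ₚ (f z) _ t) (trans (cong (λ e → eval (f z) t ℤ.+ e) rest≡0) (ℤₚ.+-identityʳ _))
  where
  eval-sumₚ-zero : ∀ L → (∀ {z} → z ∈ L → eval (f z) t ≡ + 0) → eval (sumₚ (map f L)) t ≡ + 0
  eval-sumₚ-zero []      _    = refl
  eval-sumₚ-zero (z ∷ L) f≡0 = trans (eval-+ₚ (f z) _ t)
    (cong₂ ℤ._+_ (f≡0 (here refl)) (eval-sumₚ-zero L λ z∈L → f≡0 (there z∈L)))
  rest≡0 : eval (sumₚ (map f L)) t ≡ + 0
  rest≡0 = eval-sumₚ-zero L λ z′∈L → others (there z′∈L) λ z′≡z → All.lookup z∉L z′∈L (sym z′≡z)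
eval-sumₚ-map f (z ∷ L) {x} t (z∉L ∷ L!) (there x∈L) others =
  trans (eval-+ₚ (f z) _ t) (trans (cong₂ ℤ._+_ z≡0 rest≡x) (ℤₚ.+-identityˡ _))
  where
  z≡0 : eval (f z) t ≡ + 0
  z≡0 = others (here refl) (All.lookup z∉L x∈L)
  rest≡x : eval (sumₚ (map f L)) t ≡ eval (f x) t
  rest≡x = eval-sumₚ-map f L t L! x∈L λ z∈L → others (there z∈L)

module TernaryPartitions (n : ℕ) where

  a : ℕ → ℕ
  a = div3^ n

  ν : List ℕ → ℕ → ℕ
  ν λs i = ∑[ i ≤ k < suc n ] mult λs (3 ^ k)

  c : List ℕ → ℕ → ℕ
  c λs j = a j ∸ ν λs j

  quotient : List ℕ → Poly
  quotient λs = ∏[ j < suc n ] (Q j ^ₚ c λs j)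

  G₀ : Poly
  G₀ = ∏[ k < suc n ] (P k ^ₚ a (suc k))

  ones : List ℕ
  ones = replicate n 1

  rest : List ℕ → Poly
  rest λs = ∏[ j < n ] (Q (suc j) ^ₚ c λs (suc j))

  n%3^ : ℕ → ℕ
  n%3^ j = _%_ n (3 ^ j) {{ℕₚ.m^n≢0 3 j}}

  greedy : ℕ → List ℕ
  greedy j = replicate (a j) (3 ^ j) ++ replicate (n%3^ j) 1

  a-0 : a 0 ≡ n
  a-0 = n/1≡n n

  a-vanishes : a (suc n) ≡ 0
  a-vanishes = m<n⇒m/n≡0 {{ℕₚ.m^n≢0 3 (suc n)}} (ℕₚ.<-trans (ℕₚ.n<1+n n) (n<3^n (suc n)))

  ν≤a : ∀ {λs} → sum λs ≡ n → ∀ i → ν λs i ≤ a i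
  ν≤a {λs} Σλs≡n i = m*n≤o⇒m≤o/n (ν λs i) (3 ^ i) {{ℕₚ.m^n≢0 3 i}} (begin
    ν λs i * 3 ^ i        ≡⟨ cong (λ e → ν λs i * 3 ^ e) (ℕₚ.+-identityʳ i) ⟨
    ν λs i * 3 ^ (i + 0)  ≤⟨ ∑-mult*s₀≤sum λs (λ k → 3 ^ (i + k)) (suc n ∸ i) 3^-increasing ⟩
    sum λs                ≡⟨ Σλs≡n ⟩
    n                     ∎)
    where
    open ℕₚ.≤-Reasoning
    3^-increasing : StrictlyIncreasing (λ k → 3 ^ (i + k))
    3^-increasing k l k<l = ℕₚ.^-monoʳ-< 3 (s≤s (s≤s z≤n)) (ℕₚ.+-monoʳ-< i k<l)

  hT≈quotient*G₀ : ∀ {λs} → IsTernaryPartition n λs → hT n λs ≈ (quotient λs *ₚ G₀)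
  hT≈quotient*G₀ {λs} (_ , _ , Σλs≡n) = begin
    hT n λs
      ≈⟨ ≈-reflexive (prodₚ-map-applyUpTo (λ k → P k ^ₚ (a k ∸ μ k)) (λ k → k) (suc n)) ⟩
    ∏[ k < suc n ] (P k ^ₚ (a k ∸ μ k))
      ≈⟨ ∏-cong (suc n) (λ k _ → ^ₚ-cong (a k ∸ μ k) (P≈∏Q k)) ⟩
    ∏[ k < suc n ] (∏ₚ (suc k) Q ^ₚ (a k ∸ μ k))
      ≈⟨ prefix-product-factorisation Q a μ (suc n) (λ i _ → ν≤a {λs} Σλs≡n i) a-vanishes ⟩
    quotient λs *ₚ (∏[ k < suc n ] (∏ₚ (suc k) Q ^ₚ a (suc k)))
      ≈⟨ *ₚ-congʳ (quotient λs) (∏-cong (suc n) λ k _ → ^ₚ-cong (a (suc k)) (≈-sym (P≈∏Q k))) ⟩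
    quotient λs *ₚ G₀
      ∎
    where
    open ≈-Reasoning
    μ : ℕ → ℕ
    μ k = mult λs (3 ^ k)

  G₀-monic : Monic G₀
  G₀-monic = ∏-Monic (λ k → P k ^ₚ a (suc k)) (suc n) λ k → Monic-^ₚ (a (suc k)) (Monic-1+monomial (ℕₚ.m^n>0 3 k))

  ones-partition : IsTernaryPartition n ones
  ones-partition = Linked-replicate n 1 , Allₚ.replicate⁺ n (0 , refl) , trans (sum-replicate n 1) (ℕₚ.*-identityʳ n)

  greedy-partition : ∀ j → IsTernaryPartition n (greedy j)
  greedy-partition j =
    Linked-replicate-++ (a j) (3 ^ j) (Allₚ.replicate⁺ r (ℕₚ.m^n>0 3 j)) (Linked-replicate r 1) ,
    Allₚ.++⁺ (Allₚ.replicate⁺ (a j) (j , refl)) (Allₚ.replicate⁺ r (0 , refl)) ,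
    (begin
      sum (greedy j)                                       ≡⟨ sum-++ (replicate (a j) (3 ^ j)) _ ⟩
      sum (replicate (a j) (3 ^ j)) + sum (replicate r 1)  ≡⟨ cong₂ _+_ (sum-replicate (a j) _) (sum-replicate r 1) ⟩
      a j * 3 ^ j + r * 1                                  ≡⟨ cong (λ m → a j * 3 ^ j + m) (ℕₚ.*-identityʳ r) ⟩
      a j * 3 ^ j + r                                      ≡⟨ ℕₚ.+-comm _ r ⟩
      r + a j * 3 ^ j                                      ≡⟨ m≡m%n+[m/n]*n n (3 ^ j) {{ℕₚ.m^n≢0 3 j}} ⟨
      n                                                    ∎)
    where
    open ≡-Reasoning
    r : ℕ
    r = n%3^ j

  c-ones-0 : c ones 0 ≡ 0
  c-ones-0 = ℕₚ.m≤n⇒m∸n≡0 (begin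
    a 0          ≡⟨ a-0 ⟩
    n            ≡⟨ mult-replicate n 1 ⟨
    mult ones 1  ≤⟨ head≤∑-range (λ k → mult ones (3 ^ k)) {0} {suc n} (s≤s z≤n) ⟩
    ν ones 0     ∎)
    where open ℕₚ.≤-Reasoning

  c-ones-suc : ∀ j → c ones (suc j) ≡ a (suc j)
  c-ones-suc j = cong (a (suc j) ∸_) (∑-zero (λ k → mult ones (3 ^ suc (j + k))) (suc n ∸ suc j)
                                           λ k → mult-replicate-≢ n (1≢3^suc (j + k)))
    where
    1≢3^suc : ∀ m → 1 ≢ 3 ^ suc m
    1≢3^suc m 1≡3^suc = ℕₚ.<-irrefl 1≡3^suc (ℕₚ.^-monoʳ-< 3 (s≤s (s≤s z≤n)) (s≤s (z≤n {m})))

  c-greedy : ∀ j → j ≤ n → c (greedy j) j ≡ 0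
  c-greedy j j≤n = ℕₚ.m≤n⇒m∸n≡0 (begin
    a j                                                          ≡⟨ mult-replicate (a j) (3 ^ j) ⟨
    mult (replicate (a j) (3 ^ j)) (3 ^ j)                       ≤⟨ ℕₚ.m≤m+n _ _ ⟩
    mult (replicate (a j) (3 ^ j)) (3 ^ j) + mult ones% (3 ^ j)  ≡⟨ mult-++ (replicate (a j) (3 ^ j)) ones% (3 ^ j) ⟨
    mult (greedy j) (3 ^ j)                                      ≤⟨ head≤∑-range (λ k → mult (greedy j) (3 ^ k)) (s≤s j≤n) ⟩
    ν (greedy j) j                                               ∎)
    where
    open ℕₚ.≤-Reasoning
    ones% : List ℕ
    ones% = replicate (n%3^ j) 1

  ν₀≥n⇒ones : ∀ {λs} → IsTernaryPartition n λs → n ≤ ν λs 0 → λs ≡ ones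
  ν₀≥n⇒ones {λs} (_ , powers , Σλs≡n) n≤ν₀ =
    trans (length≡sum⇒ones parts≥1 (trans length≡n (sym Σλs≡n))) (cong (λ m → replicate m 1) length≡n)
    where
    parts≥1 : All (1 ≤_) λs
    parts≥1 = powers-of-3-positive powers
    length≤n : length λs ≤ n
    length≤n = subst (length λs ≤_) Σλs≡n (length≤sum parts≥1)
    length≡n : length λs ≡ n
    length≡n = ℕₚ.≤-antisym length≤n
      (ℕₚ.≤-trans n≤ν₀ (∑-mult≤length λs (λ k → 3 ^ k) (suc n) λ k l k<l → ℕₚ.^-monoʳ-< 3 (s≤s (s≤s z≤n)) k<l))

  c₀-positive : ∀ {λs} → IsTernaryPartition n λs → λs ≢ ones → 0 < c λs 0
  c₀-positive {λs} λs-partition λs≢ones with ν λs 0 ℕ.<? a 0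
  ... | yes ν₀<a₀ = ℕₚ.m<n⇒0<n∸m ν₀<a₀
  ... | no  ν₀≮a₀ = ⊥-elim (λs≢ones (ν₀≥n⇒ones λs-partition (subst (_≤ ν λs 0) a-0 (ℕₚ.≮⇒≥ ν₀≮a₀))))

  quotient-at-0 : ∀ λs → eval (quotient λs) (+ 0) ≡ + 1
  quotient-at-0 λs = trans
    (eval-∏-^ (λ j → Q j ^ₚ c λs j) (suc n) (+ 0) 1 (c λs) λ j _ → eval-^ₚ (Q j) (c λs j) (+ 0) (eval-Q-0 j))
    (cong +_ (ℕₚ.^-zeroˡ (∑ (suc n) (c λs))))

  quotient-at-[-1] : ∀ {λs} → IsTernaryPartition n λs → λs ≢ ones → eval (quotient λs) -1ℤ ≡ + 0
  quotient-at-[-1] {λs} λs-partition λs≢ones = begin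
    eval (quotient λs) -1ℤ                           ≡⟨ eval-*ₚ (Q 0 ^ₚ c λs 0) (rest λs) -1ℤ ⟩
    eval (Q 0 ^ₚ c λs 0) -1ℤ ℤ.* eval (rest λs) -1ℤ  ≡⟨ cong (ℤ._* eval (rest λs) -1ℤ) Q₀-factor ⟩
    + 0 ℤ.* eval (rest λs) -1ℤ                       ≡⟨ ℤₚ.*-zeroˡ (eval (rest λs) -1ℤ) ⟩
    + 0                                              ∎
    where
    open ≡-Reasoning
    0^-positive : ∀ {m} → 0 < m → 0 ^ m ≡ 0
    0^-positive {suc m} _ = refl
    Q₀-factor : eval (Q 0 ^ₚ c λs 0) -1ℤ ≡ + 0
    Q₀-factor = trans (eval-^ₚ (Q 0) (c λs 0) -1ℤ eval-Q₀-[-1])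
                      (cong +_ (0^-positive (c₀-positive λs-partition λs≢ones)))

  quotient-ones-at-[-1] : eval (quotient ones) -1ℤ ≡ + (3 ^ legendre-sum n)
  quotient-ones-at-[-1] = begin
    eval (quotient ones) -1ℤ                             ≡⟨ eval-*ₚ (Q 0 ^ₚ c ones 0) (rest ones) -1ℤ ⟩
    eval (Q 0 ^ₚ c ones 0) -1ℤ ℤ.* eval (rest ones) -1ℤ  ≡⟨ cong₂ ℤ._*_ Q₀-factor rest-factor ⟩
    + 1 ℤ.* + (3 ^ legendre-sum n)                       ≡⟨ ℤₚ.*-identityˡ _ ⟩
    + (3 ^ legendre-sum n)                               ∎
    where
    open ≡-Reasoning
    Q₀-factor : eval (Q 0 ^ₚ c ones 0) -1ℤ ≡ + 1
    Q₀-factor = trans (eval-^ₚ (Q 0) (c ones 0) -1ℤ eval-Q₀-[-1]) (cong (λ e → + (0 ^ e)) c-ones-0)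
    rest-factor : eval (rest ones) -1ℤ ≡ + (3 ^ legendre-sum n)
    rest-factor = trans
      (eval-∏-^ (λ j → Q (suc j) ^ₚ c ones (suc j)) n -1ℤ 3 (λ j → c ones (suc j))
                λ j _ → eval-^ₚ (Q (suc j)) (c ones (suc j)) -1ℤ (eval-Q-suc-[-1] j))
      (cong (λ e → + (3 ^ e)) (∑-cong n λ j _ → c-ones-suc j))

  quotients-coprime : ∀ R → (∀ {λs} → IsTernaryPartition n λs → R ∣ quotient λs) → R ∣ oneₚ
  quotients-coprime R R∣quotient =
    constₚ-∣⇒∣oneₚ (proj₂ (proj₂ R-constant)) (R∣quotient ones-partition) (quotient-at-0 ones)
    where
    g : ℕ → Poly
    g j = Q j ^ₚ c ones j
    cancellable : ∀ j → j < suc n → Σ Poly λ B → R ∣ B × Coprime₃ (g j) B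
    cancellable zero    _ = R , ∣ʳ-refl , Coprime₃-respˡ-≈ (^ₚ-congʳ (Q 0) (sym c-ones-0)) (Coprime₃-oneₚ R)
    cancellable (suc j) (s≤s j<n) =
      quotient (greedy (suc j)) , R∣quotient (greedy-partition (suc j)) ,
      Coprime₃-sym (Coprime₃-∏ (λ i → Q i ^ₚ c (greedy (suc j)) i) (suc n) λ i _ → factor-coprime i)
      where
      factor-coprime : ∀ i → Coprime₃ (Q i ^ₚ c (greedy (suc j)) i) (g (suc j))
      factor-coprime i with i ℕ.≟ suc j
      ... | yes refl = Coprime₃-respˡ-≈ (^ₚ-congʳ (Q (suc j)) (sym (c-greedy (suc j) j<n))) (Coprime₃-oneₚ _)
      ... | no  i≢j+1 = Coprime₃-^ₚ (c (greedy (suc j)) i)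
                          (Coprime₃-sym (Coprime₃-^ₚ (c ones (suc j)) (Coprime₃-sym (Q-Coprime₃ i≢j+1))))
    R∣3ˢ : Σ ℕ λ s → R ∣ (3^ₚ s *ₚ oneₚ)
    R∣3ˢ = ∣-∏-cancel-Coprime₃ g (suc n) oneₚ cancellable
             (∣ʳ-respʳ-≈ (≈-sym (*ₚ-identityˡ (quotient ones))) (R∣quotient ones-partition))
    R-constant : Σ ℤ λ r → (r ≢ + 0) × (R ≈ constₚ r)
    R-constant = ∣constₚ⇒constₚ (3^≢0 (proj₁ R∣3ˢ)) (∣ʳ-respʳ-≈ (*ₚ-identityʳ _) (proj₂ R∣3ˢ))

  numT-at-[-1]≡3^legendre-sum : NumTAtMinusOne n (+ (3 ^ legendre-sum n))
  numT-at-[-1]≡3^legendre-sum L L! L⇔T G G-gcd N NG≈∑h =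
    trans (eval-cong -1ℤ N≈∑quotient)
      (trans (eval-sumₚ-map quotient L -1ℤ L! (partition⇒∈ ones-partition)
                λ λs∈L λs≢ones → quotient-at-[-1] (∈⇒partition λs∈L) λs≢ones)
             quotient-ones-at-[-1])
    where
    partition⇒∈ : ∀ {λs} → IsTernaryPartition n λs → λs ∈ L
    partition⇒∈ {λs} = Equivalence.from (L⇔T λs)
    ∈⇒partition : ∀ {λs} → λs ∈ L → IsTernaryPartition n λs
    ∈⇒partition {λs} = Equivalence.to (L⇔T λs)
    h≈quotient*G₀ : ∀ {λs} → λs ∈ L → hT n λs ≈ (quotient λs *ₚ G₀)
    h≈quotient*G₀ λs∈L = hT≈quotient*G₀ (∈⇒partition λs∈L)
    G≈G₀ : G ≈ G₀
    G≈G₀ = gcd-of-coprime-multiples L (hT n) quotient G₀-monic h≈quotient*G₀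
             (λ R R∣quotients → quotients-coprime R λ λs-partition → R∣quotients (partition⇒∈ λs-partition))
             G-gcd
    N≈∑quotient : N ≈ sumₚ (map quotient L)
    N≈∑quotient = *ₚ-cancelʳ (Monic⇒Nonzero G₀-monic) (begin
      N *ₚ G₀                                  ≈⟨ *ₚ-congʳ N (≈-sym G≈G₀) ⟩
      N *ₚ G                                   ≈⟨ coeffwise NG≈∑h ⟩
      sumₚ (map (hT n) L)                      ≈⟨ sumₚ-map-cong L h≈quotient*G₀ ⟩
      sumₚ (map (λ λs → quotient λs *ₚ G₀) L)  ≈⟨ sumₚ-map-*ₚ quotient G₀ L ⟩
      sumₚ (map quotient L) *ₚ G₀              ∎)
      where open ≈-Reasoning

numT-at-[-1]≡3^v₃ : ∀ n e → IsV3 (n !) e → NumTAtMinusOne n (+ (3 ^ e))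
numT-at-[-1]≡3^v₃ n e v = subst (λ e → NumTAtMinusOne n (+ (3 ^ e)))
                                (IsV3-unique (legendre-sum n) e (legendre n) v)
                                (TernaryPartitions.numT-at-[-1]≡3^legendre-sum n)

theorem4 : ((n : ℕ) → n ≥ 1 → (e : ℕ) → IsV3 (n !) e → NumTAtMinusOne n (+ (3 ^ e)))
    × ((n : ℕ) → n ≥ 1 → (e : ℕ) → IsV3 ((3 * n) !) e →
         NumTAtMinusOne (3 * n) (+ (3 ^ e)) × NumTAtMinusOne (3 * n + 1) (+ (3 ^ e))
           × NumTAtMinusOne (3 * n + 2) (+ (3 ^ e)))
theorem4 = (λ n _ → numT-at-[-1]≡3^v₃ n)
         , (λ n _ e v → numT-at-[-1]≡3^v₃ (3 * n) e v
                      , numT-at-[-1]≡3^v₃ (3 * n + 1) e (IsV3-3n+1 n e v)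
                      , numT-at-[-1]≡3^v₃ (3 * n + 2) e (IsV3-3n+2 n e v))
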